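{- Let $\Gamma$ be a global context all of whose rewrite rules satisfy the encoding conditions. If the HRS $\mathrm{HRS}(\beta\Gamma)$ is confluent, then product compatibility $\mathbf{PC}(\Gamma)$ holds.
   Context: The $\lambda\Pi$-calculus modulo. Objects $t ::= x \mid c \mid t\,t \mid \lambda x:U.t$; types $U,V ::= C \mid U\,t \mid \lambda x:U.V \mid \Pi x:U.V$; kinds $K ::= \mathrm{Type}\mid\Pi x:U.K$; a term is an object, type, kind or $\mathrm{Kind}$; sorts $s\in\{\mathrm{Type},\mathrm{Kind}\}$. Local context: list of $(x:U)$; global context: list of $(c:U)$, $(C:K)$ and rewrite rules $(u\to v)$ (pairs of objects or of types). $\to_\beta$: least relation containing $(\lambda x:A.u)v\to u[x/v]$, closed under subterms; $\to_\Gamma$: least relation containing the rules of $\Gamma$, closed under arbitrary substitution and subterms; $\equiv_{\beta\Gamma}$: congruence generated by $\to_\beta\cup\to_\Gamma$. Typing: (Sort) $\Gamma;\Delta\vdash\mathrm{Type}:\mathrm{Kind}$; (Variable) $(x:A)\in\Delta\Rightarrow\Gamma;\Delta\vdash x:A$; (Constant) $(c:A)\in\Gamma\Rightarrow\Gamma;\Delta\vdash c:A$; (Application) $\Gamma;\Delta\vdash t:\Pi x:A.B$, $\Gamma;\Delta\vdash u:A\Rightarrow\Gamma;\Delta\vdash tu:B[x/u]$; (Abstraction) $\Gamma;\Delta\vdash A:\mathrm{Type}$, $\Gamma;\Delta(x:A)\vdash t:B$, $B\ne\mathrm{Kind}\Rightarrow\Gamma;\Delta\vdash\lambda x:A.t:\Pi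 x:A.B$; (Product) $\Gamma;\Delta\vdash A:\mathrm{Type}$, $\Gamma;\Delta(x:A)\vdash B:s\Rightarrow\Gamma;\Delta\vdash\Pi x:A.B:s$; (Conversion) $\Gamma;\Delta\vdash t:A$, $\Gamma;\Delta\vdash B:s$, $A\equiv_{\beta\Gamma}B\Rightarrow\Gamma;\Delta\vdash t:B$. Well-formed local contexts: $\vdash_\Gamma\emptyset$; $\vdash_\Gamma\Delta$, $\Gamma;\Delta\vdash U:\mathrm{Type}$, $x\notin dom(\Delta)\Rightarrow\vdash_\Gamma\Delta(x:U)$. $\mathbf{PC}(\Gamma)$: whenever $\Pi x:A_1.B_1$ and $\Pi x:A_2.B_2$ are well-typed in the same well-formed local context and $\Pi x:A_1.B_1\equiv_{\beta\Gamma}\Pi x:A_2.B_2$, then $A_1\equiv_{\beta\Gamma}A_2$ and $B_1\equiv_{\beta\Gamma}B_2$. HRS: simple types over base type $\mathtt{term}$; $\mathtt{term}^1=\mathtt{term}$, $\mathtt{term}^{n+1}=\mathtt{term}\to\mathtt{term}^n$. Signature: $\mathtt{Type},\mathtt{Kind}:\mathtt{term}$, $\mathtt{app}:\mathtt{term}\to\mathtt{term}\to\mathtt{term}$, $\mathtt{lam},\mathtt{pi}:\mathtt{term}\to(\mathtt{term}\to\mathtt{term})\to\mathtt{term}$, $\mathtt{c}:\mathtt{term}$ per constant $c$. HRS-terms: simply typed $\lambda$-terms ($t(u)$, $\underline\lambda x.t$) in long $\beta\eta$-normal form; $\Downarrow t$ long $\beta\eta$-normal form. Pattern: every free occurrence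 of a variable $F$ is in a subterm $F(u_1,\dots,u_n)$ with the $u_i$ $\eta$-equivalent to distinct bound variables. HRS rule $(l\to r)$: same base type, $l$ a pattern not $\eta$-equivalent to a variable, $FV(r)\subseteq FV(l)$. For a set $R$ of rules, $\to_R$ is the least relation on HRS-terms closed under subterms with $\Downarrow\sigma(l)\to_R\Downarrow\sigma(r)$ for each rule and well-typed substitution $\sigma$; $R$ is confluent if $\to_R$ is. Encoding: for $t$ uniform in $V$ (all occurrences of each free variable of $t$ not in $V$ applied to the same number of arguments), $[\![\mathrm{Kind}]\!]_V=\mathtt{Kind}$, $[\![\mathrm{Type}]\!]_V=\mathtt{Type}$, $[\![c]\!]_V=\mathtt{c}$, $[\![x]\!]_V=x:\mathtt{term}$ if $x\in V$, $[\![\lambda x:A.u]\!]_V=\mathtt{lam}([\![A]\!]_V,\underline\lambda x.[\![u]\!]_{V\cup\{x\}})$, $[\![\Pi x:A.B]\!]_V=\mathtt{pi}([\![A]\!]_V,\underline\lambda x.[\![B]\!]_{V\cup\{x\}})$, $[\![x\,v_1\dots v_n]\!]_V=x([\![v_1]\!]_V,\dots,[\![v_n]\!]_V)$ for $x\notin V$ ($x:\mathtt{term}^{n+1}$), $[\![uv]\!]_V=\mathtt{app}([\![u]\!]_V,[\![v]\!]_V)$ otherwise. $\lambda\Pi$-patterns: for $V=(V_0,\mathcal A)$ ($\mathcal A$ arity function), $\mathcal P_V$ is least with: constants; $pq$ for $p,q\in\mathcal P_V$; $x\in V_0$; $p\,(x\vec y)$ for $p\in\mathcal P_V$, $x\notin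 V_0$, $\vec y$ pairwise distinct in $V_0$ with $|\vec y|=\mathcal A(x)$; $p\,(\lambda x:A.q)$ for $p\in\mathcal P_V$, $FV(A)\subseteq V_0$, $q\in\mathcal P_{(V_0\cup\{x\},\mathcal A)}$. A $\lambda\Pi$-pattern is an element of some $\mathcal P_{(\emptyset,\mathcal A)}$. Encoding conditions on a rule $(u\to v)$: $u$ a $\lambda\Pi$-pattern, $FV(v)\subseteq FV(u)$, every free variable applied to the same number of arguments at all its occurrences in $u$ and $v$; $[\![u\to v]\!]=([\![u]\!]_\emptyset\to[\![v]\!]_\emptyset)$. $\mathrm{HRS}(\beta\Gamma)=\{[\![u\to v]\!]:(u\to v)\in\Gamma\}\cup\{\mathtt{app}(\mathtt{lam}(X,\underline\lambda x.Y(x)),Z)\to Y(Z)\}$ (with $X,Z:\mathtt{term}$, $Y:\mathtt{term}\to\mathtt{term}$). -}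

module Defs where

open import Data.Nat using (ℕ; zero; suc; _+_; _<_)
open import Data.Fin using (Fin; toℕ) renaming (zero to fz; suc to fs)
open import Data.List using (List; []; _∷_; _++_; replicate)
open import Data.List.Membership.Propositional using (_∈_)
open import Data.List.Relation.Unary.All using (All)
open import Data.Vec using (Vec; []; _∷_; lookup)
open import Data.Product using (Σ; ∃; _×_; _,_)
open import Data.Sum using (_⊎_)
open import Relation.Nullary using (¬_)
open import Relation.Binary.PropositionalEquality using (_≡_; _≢_)
open import Relation.Binary.Construct.Closure.Equivalence using (EqClosure)
open import Relation.Binary.Construct.Closure.ReflexiveTransitive using (Star)

-- Part 1. The λΠ-calculus modulo (de Bruijn indices; var 0 = innermost)

-- Pre-terms.  ocon = object constants c, tcon = type constants C.
-- lam A t and pi A B bind variable 0 in t / B.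
data Term : Set where
  kind type : Term
  var       : ℕ → Term
  ocon tcon : ℕ → Term
  app       : Term → Term → Term
  lam pi    : Term → Term → Term

mutual
  data IsObj : Term → Set where
    o-var : ∀ {x} → IsObj (var x)
    o-con : ∀ {c} → IsObj (ocon c)
    o-app : ∀ {t u} → IsObj t → IsObj u → IsObj (app t u)
    o-lam : ∀ {U t} → IsTy U → IsObj t → IsObj (lam U t)

  data IsTy : Term → Set where
    t-con : ∀ {C} → IsTy (tcon C)
    t-app : ∀ {U t} → IsTy U → IsObj t → IsTy (app U t)
    t-lam : ∀ {U V} → IsTy U → IsTy V → IsTy (lam U V)
    t-pi  : ∀ {U V} → IsTy U → IsTy V → IsTy (pi U V)

data IsKind : Term → Set where
  k-type : IsKind type
  k-pi   : ∀ {U K} → IsTy U → IsKind K → IsKind (pi U K)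

data IsSort : Term → Set where
  s-type : IsSort type
  s-kind : IsSort kind

extR : (ℕ → ℕ) → ℕ → ℕ
extR ρ zero    = zero
extR ρ (suc n) = suc (ρ n)

ren : (ℕ → ℕ) → Term → Term
ren ρ kind     = kind
ren ρ type     = type
ren ρ (var x)  = var (ρ x)
ren ρ (ocon c) = ocon c
ren ρ (tcon c) = tcon c
ren ρ (app t u) = app (ren ρ t) (ren ρ u)
ren ρ (lam A t) = lam (ren ρ A) (ren (extR ρ) t)
ren ρ (pi A B)  = pi (ren ρ A) (ren (extR ρ) B)

shift : Term → Term
shift = ren suc

extS : (ℕ → Term) → ℕ → Term
extS σ zero    = var zero
extS σ (suc n) = shift (σ n)

sub : (ℕ → Term) → Term → Term
sub σ kind     = kind
sub σ type     = type
sub σ (var x)  = σ x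
sub σ (ocon c) = ocon c
sub σ (tcon c) = tcon c
sub σ (app t u) = app (sub σ t) (sub σ u)
sub σ (lam A t) = lam (sub σ A) (sub (extS σ) t)
sub σ (pi A B)  = pi (sub σ A) (sub (extS σ) B)

single : Term → ℕ → Term
single u zero    = u
single u (suc n) = var n

-- B [ u ]  is  B[x/u]  where x is variable 0 of B.
_[_] : Term → Term → Term
B [ u ] = sub (single u) B

-- Global contexts: declarations (c : U), (C : K) and rewrite rules (u → v).
-- The free variables of a rule are its free de Bruijn indices.
data GEntry : Set where
  odecl : ℕ → Term → GEntry
  tdecl : ℕ → Term → GEntry
  rule  : Term → Term → GEntry

GCtx : Set
GCtx = List GEntry

WFEntry : GEntry → Set
WFEntry (odecl c U) = IsTy U
WFEntry (tdecl C K) = IsKind K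
WFEntry (rule u v)  = (IsObj u × IsObj v) ⊎ (IsTy u × IsTy v)

IsGlobal : GCtx → Set
IsGlobal Γ = All WFEntry Γ

data _⊢_⟶_ (Γ : GCtx) : Term → Term → Set where
  β     : ∀ {A u v} → Γ ⊢ app (lam A u) v ⟶ (u [ v ])
  γ     : ∀ {l r} → rule l r ∈ Γ → (σ : ℕ → Term) → Γ ⊢ sub σ l ⟶ sub σ r
  appₗ  : ∀ {t t' u} → Γ ⊢ t ⟶ t' → Γ ⊢ app t u ⟶ app t' u
  appᵣ  : ∀ {t u u'} → Γ ⊢ u ⟶ u' → Γ ⊢ app t u ⟶ app t u'
  lamₗ  : ∀ {A A' t} → Γ ⊢ A ⟶ A' → Γ ⊢ lam A t ⟶ lam A' t
  lamᵣ  : ∀ {A t t'} → Γ ⊢ t ⟶ t' → Γ ⊢ lam A t ⟶ lam A t'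
  piₗ   : ∀ {A A' B} → Γ ⊢ A ⟶ A' → Γ ⊢ pi A B ⟶ pi A' B
  piᵣ   : ∀ {A B B'} → Γ ⊢ B ⟶ B' → Γ ⊢ pi A B ⟶ pi A B'

_⊢_≡βΓ_ : GCtx → Term → Term → Set
Γ ⊢ t ≡βΓ u = EqClosure (Γ ⊢_⟶_) t u

-- Local contexts: the head of the list is the type of variable 0.
LCtx : Set
LCtx = List Term

data _∋_⦂_ : LCtx → ℕ → Term → Set where
  here  : ∀ {Δ A} → (A ∷ Δ) ∋ zero ⦂ shift A
  there : ∀ {Δ A B x} → Δ ∋ x ⦂ A → (B ∷ Δ) ∋ suc x ⦂ shift A

data _⨾_⊢_∶_ (Γ : GCtx) : LCtx → Term → Term → Set where
  sort   : ∀ {Δ} → Γ ⨾ Δ ⊢ type ∶ kind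
  varT   : ∀ {Δ x A} → Δ ∋ x ⦂ A → Γ ⨾ Δ ⊢ var x ∶ A
  oconT  : ∀ {Δ c A} → odecl c A ∈ Γ → Γ ⨾ Δ ⊢ ocon c ∶ A
  tconT  : ∀ {Δ C A} → tdecl C A ∈ Γ → Γ ⨾ Δ ⊢ tcon C ∶ A
  appT   : ∀ {Δ t u A B} → Γ ⨾ Δ ⊢ t ∶ pi A B → Γ ⨾ Δ ⊢ u ∶ A →
           Γ ⨾ Δ ⊢ app t u ∶ (B [ u ])
  absT   : ∀ {Δ A t B} → Γ ⨾ Δ ⊢ A ∶ type → Γ ⨾ (A ∷ Δ) ⊢ t ∶ B → B ≢ kind →
           Γ ⨾ Δ ⊢ lam A t ∶ pi A B
  prodT  : ∀ {Δ A B s} → IsSort s → Γ ⨾ Δ ⊢ A ∶ type → Γ ⨾ (A ∷ Δ) ⊢ B ∶ s →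
           Γ ⨾ Δ ⊢ pi A B ∶ s
  convT  : ∀ {Δ t A B s} → IsSort s → Γ ⨾ Δ ⊢ t ∶ A → Γ ⨾ Δ ⊢ B ∶ s →
           Γ ⊢ A ≡βΓ B → Γ ⨾ Δ ⊢ t ∶ B

data WF (Γ : GCtx) : LCtx → Set where
  wf-nil  : WF Γ []
  wf-cons : ∀ {Δ U} → WF Γ Δ → Γ ⨾ Δ ⊢ U ∶ type → WF Γ (U ∷ Δ)

PC : GCtx → Set
PC Γ = ∀ {Δ A₁ B₁ A₂ B₂ T₁ T₂} → WF Γ Δ →
       Γ ⨾ Δ ⊢ pi A₁ B₁ ∶ T₁ → Γ ⨾ Δ ⊢ pi A₂ B₂ ∶ T₂ →
       Γ ⊢ pi A₁ B₁ ≡βΓ pi A₂ B₂ →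
       (Γ ⊢ A₁ ≡βΓ A₂) × (Γ ⊢ B₁ ≡βΓ B₂)

-- Part 2. Encoding conditions on rewrite rules

apps : ∀ {n} → Term → Vec Term n → Term
apps t []       = t
apps t (v ∷ vs) = apps (app t v) vs

headOf : Term → Term
headOf (app t u) = headOf t
headOf t         = t

-- At binder depth k, the head of t is a free variable (index k + j).
FreeHead : ℕ → Term → Set
FreeHead k t = Σ ℕ λ j → headOf t ≡ var (k + j)

data Occurs : ℕ → Term → Set where
  oc-var  : ∀ {i} → Occurs i (var i)
  oc-appₗ : ∀ {i t u} → Occurs i t → Occurs i (app t u)
  oc-appᵣ : ∀ {i t u} → Occurs i u → Occurs i (app t u)
  oc-lamₗ : ∀ {i A t} → Occurs i A → Occurs i (lam A t)
  oc-lamᵣ : ∀ {i A t} → Occurs (suc i) t → Occurs i (lam A t)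
  oc-piₗ  : ∀ {i A B} → Occurs i A → Occurs i (pi A B)
  oc-piᵣ  : ∀ {i A B} → Occurs (suc i) B → Occurs i (pi A B)

Distinct : ∀ {n} → Vec ℕ n → Set
Distinct {n} ys = (a b : Fin n) → lookup ys a ≡ lookup ys b → a ≡ b

-- λΠ-patterns P_(V0,𝒜): k = number of variables of V0 (the bound
-- variables, indices < k); free variable k + j has arity ar j.
data Pat (k : ℕ) (ar : ℕ → ℕ) : Term → Set where
  p-ocon : ∀ {c} → Pat k ar (ocon c)
  p-tcon : ∀ {C} → Pat k ar (tcon C)
  p-app  : ∀ {p q} → Pat k ar p → Pat k ar q → Pat k ar (app p q)
  p-bvar : (i : Fin k) → Pat k ar (var (toℕ i))
  p-fvar : ∀ {p} → Pat k ar p → (j : ℕ) (ys : Vec ℕ (ar j)) →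
           All (_< k) (Data.Vec.toList ys) → Distinct ys →
           Pat k ar (app p (apps (var (k + j)) (Data.Vec.map var ys)))
  p-lam  : ∀ {p A q} → Pat k ar p → (∀ i → Occurs i A → i < k) →
           Pat (suc k) ar q → Pat k ar (app p (lam A q))

IsλΠPattern : Term → Set
IsλΠPattern u = Σ (ℕ → ℕ) λ ar → Pat 0 ar u

-- Uniformity: every free variable (index k + j at depth k) occurs applied
-- to exactly ar j arguments (counting its maximal application spine).
mutual
  data Unif (k : ℕ) (ar : ℕ → ℕ) : Term → Set where
    u-kind : Unif k ar kind
    u-type : Unif k ar type
    u-ocon : ∀ {c} → Unif k ar (ocon c)
    u-tcon : ∀ {C} → Unif k ar (tcon C)
    u-bvar : (i : Fin k) → Unif k ar (var (toℕ i))
    u-fvar : ∀ {n} (j : ℕ) {vs : Vec Term n} → UnifArgs k ar vs → n ≡ ar j →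
             Unif k ar (apps (var (k + j)) vs)
    u-app  : ∀ {t u} → ¬ FreeHead k t → Unif k ar t → Unif k ar u →
             Unif k ar (app t u)
    u-lam  : ∀ {A t} → Unif k ar A → Unif (suc k) ar t → Unif k ar (lam A t)
    u-pi   : ∀ {A B} → Unif k ar A → Unif (suc k) ar B → Unif k ar (pi A B)

  data UnifArgs (k : ℕ) (ar : ℕ → ℕ) : ∀ {n} → Vec Term n → Set where
    ua-nil  : UnifArgs k ar []
    ua-cons : ∀ {n v} {vs : Vec Term n} → Unif k ar v → UnifArgs k ar vs →
              UnifArgs k ar (v ∷ vs)

EncodingConditions : Term → Term → Set
EncodingConditions u v =
  IsλΠPattern u ×
  (∀ i → Occurs i v → Occurs i u) ×
  (Σ (ℕ → ℕ) λ ar → Unif 0 ar u × Unif 0 ar v)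

-- Part 3. Higher-order rewrite systems over the base type term

infixr 7 _⇒_
data Ty : Set where
  ι   : Ty
  _⇒_ : Ty → Ty → Ty

-- term^(n+1)
termTy : ℕ → Ty
termTy zero    = ι
termTy (suc n) = ι ⇒ termTy n

data HCon : Ty → Set where
  cType cKind : HCon ι
  cApp        : HCon (ι ⇒ ι ⇒ ι)
  cLam cPi    : HCon (ι ⇒ (ι ⇒ ι) ⇒ ι)
  cObj cTyp   : ℕ → HCon ι

HCtx : Set
HCtx = List Ty

data _∋ₕ_ : HCtx → Ty → Set where
  Z : ∀ {Ψ A} → (A ∷ Ψ) ∋ₕ A
  S : ∀ {Ψ A B} → Ψ ∋ₕ A → (B ∷ Ψ) ∋ₕ A

∋-index : ∀ {Ψ A} → Ψ ∋ₕ A → ℕ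
∋-index Z     = zero
∋-index (S x) = suc (∋-index x)

infixl 8 _·_
data Tm (Ψ : HCtx) : Ty → Set where
  `_  : ∀ {A} → Ψ ∋ₕ A → Tm Ψ A
  con : ∀ {A} → HCon A → Tm Ψ A
  ƛ   : ∀ {A B} → Tm (A ∷ Ψ) B → Tm Ψ (A ⇒ B)
  _·_ : ∀ {A B} → Tm Ψ (A ⇒ B) → Tm Ψ A → Tm Ψ B

Renₕ : HCtx → HCtx → Set
Renₕ Ψ Ψ' = ∀ {A} → Ψ ∋ₕ A → Ψ' ∋ₕ A

extₕ : ∀ {Ψ Ψ' B} → Renₕ Ψ Ψ' → Renₕ (B ∷ Ψ) (B ∷ Ψ')
extₕ ρ Z     = Z
extₕ ρ (S x) = S (ρ x)

renₕ : ∀ {Ψ Ψ' A} → Renₕ Ψ Ψ' → Tm Ψ A → Tm Ψ' A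
renₕ ρ (` x)   = ` ρ x
renₕ ρ (con c) = con c
renₕ ρ (ƛ t)   = ƛ (renₕ (extₕ ρ) t)
renₕ ρ (t · u) = renₕ ρ t · renₕ ρ u

Subₕ : HCtx → HCtx → Set
Subₕ Ψ Ψ' = ∀ {A} → Ψ ∋ₕ A → Tm Ψ' A

extsₕ : ∀ {Ψ Ψ' B} → Subₕ Ψ Ψ' → Subₕ (B ∷ Ψ) (B ∷ Ψ')
extsₕ σ Z     = ` Z
extsₕ σ (S x) = renₕ S (σ x)

subₕ : ∀ {Ψ Ψ' A} → Subₕ Ψ Ψ' → Tm Ψ A → Tm Ψ' A
subₕ σ (` x)   = σ x
subₕ σ (con c) = con c
subₕ σ (ƛ t)   = ƛ (subₕ (extsₕ σ) t)
subₕ σ (t · u) = subₕ σ t · subₕ σ u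

singleₕ : ∀ {Ψ B} → Tm Ψ B → Subₕ (B ∷ Ψ) Ψ
singleₕ u Z     = u
singleₕ u (S x) = ` x

data _⟶βη_ {Ψ : HCtx} : ∀ {A} → Tm Ψ A → Tm Ψ A → Set where
  β-ƛ  : ∀ {A B} {t : Tm (A ∷ Ψ) B} {u : Tm Ψ A} →
         (ƛ t · u) ⟶βη subₕ (singleₕ u) t
  η-ƛ  : ∀ {A B} {t : Tm Ψ (A ⇒ B)} → ƛ (renₕ S t · ` Z) ⟶βη t
  ξ-ƛ  : ∀ {A B} {t t' : Tm (A ∷ Ψ) B} → t ⟶βη t' → ƛ t ⟶βη ƛ t'
  ξ-·₁ : ∀ {A B} {t t' : Tm Ψ (A ⇒ B)} {u : Tm Ψ A} → t ⟶βη t' → (t · u) ⟶βη (t' · u)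
  ξ-·₂ : ∀ {A B} {t : Tm Ψ (A ⇒ B)} {u u' : Tm Ψ A} → u ⟶βη u' → (t · u) ⟶βη (t · u')

_=βη_ : ∀ {Ψ A} → Tm Ψ A → Tm Ψ A → Set
t =βη u = EqClosure _⟶βη_ t u

mutual
  data Nf {Ψ : HCtx} : ∀ {A} → Tm Ψ A → Set where
    nf-ƛ  : ∀ {A B} {t : Tm (A ∷ Ψ) B} → Nf t → Nf (ƛ t)
    nf-ne : {t : Tm Ψ ι} → Ne t → Nf t

  data Ne {Ψ : HCtx} : ∀ {A} → Tm Ψ A → Set where
    ne-var : ∀ {A} {x : Ψ ∋ₕ A} → Ne (` x)
    ne-con : ∀ {A} {c : HCon A} → Ne (con c)
    ne-app : ∀ {A B} {t : Tm Ψ (A ⇒ B)} {u : Tm Ψ A} → Ne t → Nf u → Ne (t · u)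

IsNFOf : ∀ {Ψ A} → Tm Ψ A → Tm Ψ A → Set
IsNFOf u t = Nf u × (u =βη t)

record HRule : Set where
  constructor hrule
  field
    ctx : HCtx
    lhs : Tm ctx ι
    rhs : Tm ctx ι
open HRule public

data Step (R : HRule → Set) {Ψ : HCtx} : ∀ {A} → Tm Ψ A → Tm Ψ A → Set where
  root : ∀ {ρ u v} → R ρ → (σ : Subₕ (ctx ρ) Ψ) →
         IsNFOf u (subₕ σ (lhs ρ)) → IsNFOf v (subₕ σ (rhs ρ)) → Step R u v
  ξ-ƛ  : ∀ {A B} {t t' : Tm (A ∷ Ψ) B} → Step R t t' → Step R (ƛ t) (ƛ t')
  ξ-·₁ : ∀ {A B} {t t' : Tm Ψ (A ⇒ B)} {u : Tm Ψ A} → Step R t t' → Step R (t · u) (t' · u)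
  ξ-·₂ : ∀ {A B} {t : Tm Ψ (A ⇒ B)} {u u' : Tm Ψ A} → Step R u u' → Step R (t · u) (t · u')

Confluent : (HRule → Set) → Set
Confluent R = ∀ {Ψ A} {t u v : Tm Ψ A} → Nf t →
  Star (Step R) t u → Star (Step R) t v →
  Σ (Tm Ψ A) λ w → Star (Step R) u w × Star (Step R) v w

-- Part 4. The encoding [[_]] and HRS(βΓ)

-- HRS contexts while encoding under k λΠ-binders: k bound variables of type
-- term, then the free variables Φ (free λΠ variable k + j ↦ entry j of Φ).
bvarₕ : ∀ {Φ} (k : ℕ) → Fin k → (replicate k ι ++ Φ) ∋ₕ ι
bvarₕ (suc k) fz     = Z
bvarₕ (suc k) (fs i) = S (bvarₕ k i)

metaₕ : ∀ {Φ A} (k : ℕ) → Φ ∋ₕ A → (replicate k ι ++ Φ) ∋ₕ A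
metaₕ zero    x = x
metaₕ (suc k) x = S (metaₕ k x)

applyN : ∀ {Ψ n} → Tm Ψ (termTy n) → Vec (Tm Ψ ι) n → Tm Ψ ι
applyN f []       = f
applyN f (a ∷ as) = applyN (f · a) as

-- Enc Φ k t e :  e = [[t]]_V  where V = the k bound variables.
mutual
  data Enc (Φ : HCtx) (k : ℕ) : Term → Tm (replicate k ι ++ Φ) ι → Set where
    e-kind : Enc Φ k kind (con cKind)
    e-type : Enc Φ k type (con cType)
    e-ocon : ∀ {c} → Enc Φ k (ocon c) (con (cObj c))
    e-tcon : ∀ {C} → Enc Φ k (tcon C) (con (cTyp C))
    e-bvar : (i : Fin k) → Enc Φ k (var (toℕ i)) (` bvarₕ k i)
    e-lam  : ∀ {A t a b} → Enc Φ k A a → Enc Φ (suc k) t b →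
             Enc Φ k (lam A t) (con cLam · a · ƛ b)
    e-pi   : ∀ {A B a b} → Enc Φ k A a → Enc Φ (suc k) B b →
             Enc Φ k (pi A B) (con cPi · a · ƛ b)
    e-fvar : ∀ {n} (x : Φ ∋ₕ termTy n) {vs : Vec Term n} {as} →
             EncArgs Φ k vs as →
             Enc Φ k (apps (var (k + ∋-index x)) vs) (applyN (` metaₕ k x) as)
    e-app  : ∀ {t u a b} → ¬ FreeHead k t → Enc Φ k t a → Enc Φ k u b →
             Enc Φ k (app t u) (con cApp · a · b)

  data EncArgs (Φ : HCtx) (k : ℕ) : ∀ {n} → Vec Term n →
               Vec (Tm (replicate k ι ++ Φ) ι) n → Set where
    ea-nil  : EncArgs Φ k [] []
    ea-cons : ∀ {n v a} {vs : Vec Term n} {as} → Enc Φ k v a →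
              EncArgs Φ k vs as → EncArgs Φ k (v ∷ vs) (a ∷ as)

-- app(lam(X, λx.Y(x)), Z) → Y(Z)   with context X : term, Y : term → term, Z : term
betaRule : HRule
betaRule = hrule (ι ∷ (ι ⇒ ι) ∷ ι ∷ [])
  (con cApp · (con cLam · ` Z · ƛ (` S (S Z) · ` Z)) · ` S (S Z))
  (` S Z · ` S (S Z))

HRS-βΓ : GCtx → HRule → Set
HRS-βΓ Γ ρ = (ρ ≡ betaRule) ⊎
  (Σ Term λ u → Σ Term λ v → rule u v ∈ Γ ×
     Enc (ctx ρ) 0 u (lhs ρ) × Enc (ctx ρ) 0 v (rhs ρ))

-- The proof goes
-- through the encoding of λΠ-terms as HRS-terms, with free variables as
-- first-order HRS-variables:
--   1. Simulation: each λΠ-step t →βΓ t' is an HRS(βΓ)-step [[t]] → [[t']]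
--      (a β-step is an instance of the HRS β-rule; an instance of a rule of
--      Γ is an instance of its encoding, using the encoding conditions).
--      With confluence, convertible terms have joinable encodings.
--   2. Shape: no rule of HRS(βΓ) applies at the root of pi(a, λx.b), as a
--      Boolean model detecting the head pi shows; so reducts of an encoded
--      product are encoded products, and joinability splits componentwise.
--   3. Recovery: a decoding of HRS-terms into λΠ-terms sends HRS(βΓ)-
--      reduction to ≡βΓ (via a Kripke logical relation, which accounts for
--      the βη-normalisation built into the HRS steps) and inverts [[_]] up
--      to ≡βΓ; so terms with joinable encodings are convertible.
module Submission where

open import Defs
open import Data.Nat using (ℕ; zero; suc; _+_; _<_; _≤_; z≤n; s≤s)
open import Data.Nat.Properties using (m≤m+n; m≤n+m; <-≤-trans; <-trans; n<1+n; +-cancelˡ-<)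
open import Data.Fin using (Fin; toℕ) renaming (zero to fz; suc to fs)
open import Data.Vec as Vec using (Vec; []; _∷_)
open import Data.Sum using (inj₁; inj₂)
open import Data.Bool using (Bool; true; false)
open import Data.Empty using (⊥; ⊥-elim)
open import Data.Product using (Σ; _×_; _,_; proj₁; proj₂)
open import Data.List using ([]; _∷_; _++_; replicate; length)
open import Function using (_∘_; id)
open import Data.List.Membership.Propositional using (_∈_)
open import Relation.Binary.Construct.Closure.ReflexiveTransitive using (Star; ε; _◅_; _◅◅_)
open import Relation.Binary.Construct.Closure.Symmetric using (fwd; bwd)
import Relation.Binary.Construct.Closure.Equivalence as EqC
open import Relation.Binary.PropositionalEquality
  using (_≡_; refl; sym; trans; cong; cong₂; subst; subst₂; _≗_; module ≡-Reasoning)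

extR-cong : ∀ {ρ ρ'} → ρ ≗ ρ' → extR ρ ≗ extR ρ'
extR-cong h zero    = refl
extR-cong h (suc x) = cong suc (h x)

ren-cong : ∀ {ρ ρ'} → ρ ≗ ρ' → ren ρ ≗ ren ρ'
ren-cong h kind      = refl
ren-cong h type      = refl
ren-cong h (var x)   = cong var (h x)
ren-cong h (ocon c)  = refl
ren-cong h (tcon c)  = refl
ren-cong h (app t u) = cong₂ app (ren-cong h t) (ren-cong h u)
ren-cong h (lam A t) = cong₂ lam (ren-cong h A) (ren-cong (extR-cong h) t)
ren-cong h (pi A B)  = cong₂ pi (ren-cong h A) (ren-cong (extR-cong h) B)

extS-cong : ∀ {σ σ'} → σ ≗ σ' → extS σ ≗ extS σ'
extS-cong h zero    = refl
extS-cong h (suc x) = cong shift (h x)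

sub-cong : ∀ {σ σ'} → σ ≗ σ' → sub σ ≗ sub σ'
sub-cong h kind      = refl
sub-cong h type      = refl
sub-cong h (var x)   = h x
sub-cong h (ocon c)  = refl
sub-cong h (tcon c)  = refl
sub-cong h (app t u) = cong₂ app (sub-cong h t) (sub-cong h u)
sub-cong h (lam A t) = cong₂ lam (sub-cong h A) (sub-cong (extS-cong h) t)
sub-cong h (pi A B)  = cong₂ pi (sub-cong h A) (sub-cong (extS-cong h) B)

-- Each law has a
-- companion (suffix ↑) for the body of a binder, where both maps are lifted
-- and the lifted composite is identified with the lift of the composite.
mutual
  ren-ren : ∀ ρ ρ' t → ren ρ' (ren ρ t) ≡ ren (ρ' ∘ ρ) t
  ren-ren ρ ρ' kind      = refl
  ren-ren ρ ρ' type      = refl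
  ren-ren ρ ρ' (var x)   = refl
  ren-ren ρ ρ' (ocon c)  = refl
  ren-ren ρ ρ' (tcon c)  = refl
  ren-ren ρ ρ' (app t u) = cong₂ app (ren-ren ρ ρ' t) (ren-ren ρ ρ' u)
  ren-ren ρ ρ' (lam A t) = cong₂ lam (ren-ren ρ ρ' A) (ren-ren↑ ρ ρ' t)
  ren-ren ρ ρ' (pi A B)  = cong₂ pi (ren-ren ρ ρ' A) (ren-ren↑ ρ ρ' B)

  ren-ren↑ : ∀ ρ ρ' t → ren (extR ρ') (ren (extR ρ) t) ≡ ren (extR (ρ' ∘ ρ)) t
  ren-ren↑ ρ ρ' t =
    trans (ren-ren (extR ρ) (extR ρ') t) (ren-cong (λ { zero → refl ; (suc x) → refl }) t)

ren-shift : ∀ ρ t → ren (extR ρ) (shift t) ≡ shift (ren ρ t)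
ren-shift ρ t = trans (ren-ren suc (extR ρ) t) (sym (ren-ren ρ suc t))

mutual
  ren-sub : ∀ ρ σ t → ren ρ (sub σ t) ≡ sub (ren ρ ∘ σ) t
  ren-sub ρ σ kind      = refl
  ren-sub ρ σ type      = refl
  ren-sub ρ σ (var x)   = refl
  ren-sub ρ σ (ocon c)  = refl
  ren-sub ρ σ (tcon c)  = refl
  ren-sub ρ σ (app t u) = cong₂ app (ren-sub ρ σ t) (ren-sub ρ σ u)
  ren-sub ρ σ (lam A t) = cong₂ lam (ren-sub ρ σ A) (ren-sub↑ ρ σ t)
  ren-sub ρ σ (pi A B)  = cong₂ pi (ren-sub ρ σ A) (ren-sub↑ ρ σ B)

  ren-sub↑ : ∀ ρ σ t → ren (extR ρ) (sub (extS σ) t) ≡ sub (extS (ren ρ ∘ σ)) t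
  ren-sub↑ ρ σ t = trans (ren-sub (extR ρ) (extS σ) t)
    (sub-cong (λ { zero → refl ; (suc x) → ren-shift ρ (σ x) }) t)

mutual
  sub-ren : ∀ σ ρ t → sub σ (ren ρ t) ≡ sub (σ ∘ ρ) t
  sub-ren σ ρ kind      = refl
  sub-ren σ ρ type      = refl
  sub-ren σ ρ (var x)   = refl
  sub-ren σ ρ (ocon c)  = refl
  sub-ren σ ρ (tcon c)  = refl
  sub-ren σ ρ (app t u) = cong₂ app (sub-ren σ ρ t) (sub-ren σ ρ u)
  sub-ren σ ρ (lam A t) = cong₂ lam (sub-ren σ ρ A) (sub-ren↑ σ ρ t)
  sub-ren σ ρ (pi A B)  = cong₂ pi (sub-ren σ ρ A) (sub-ren↑ σ ρ B)

  sub-ren↑ : ∀ σ ρ t → sub (extS σ) (ren (extR ρ) t) ≡ sub (extS (σ ∘ ρ)) t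
  sub-ren↑ σ ρ t =
    trans (sub-ren (extS σ) (extR ρ) t) (sub-cong (λ { zero → refl ; (suc x) → refl }) t)

sub-shift : ∀ σ t → sub (extS σ) (shift t) ≡ shift (sub σ t)
sub-shift σ t = trans (sub-ren (extS σ) suc t) (sym (ren-sub suc σ t))

mutual
  sub-sub : ∀ σ σ' t → sub σ' (sub σ t) ≡ sub (sub σ' ∘ σ) t
  sub-sub σ σ' kind      = refl
  sub-sub σ σ' type      = refl
  sub-sub σ σ' (var x)   = refl
  sub-sub σ σ' (ocon c)  = refl
  sub-sub σ σ' (tcon c)  = refl
  sub-sub σ σ' (app t u) = cong₂ app (sub-sub σ σ' t) (sub-sub σ σ' u)
  sub-sub σ σ' (lam A t) = cong₂ lam (sub-sub σ σ' A) (sub-sub↑ σ σ' t)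
  sub-sub σ σ' (pi A B)  = cong₂ pi (sub-sub σ σ' A) (sub-sub↑ σ σ' B)

  sub-sub↑ : ∀ σ σ' t → sub (extS σ') (sub (extS σ) t) ≡ sub (extS (sub σ' ∘ σ)) t
  sub-sub↑ σ σ' t = trans (sub-sub (extS σ) (extS σ') t)
    (sub-cong (λ { zero → refl ; (suc x) → sub-shift σ' (σ x) }) t)

mutual
  sub-id : ∀ t → sub var t ≡ t
  sub-id kind      = refl
  sub-id type      = refl
  sub-id (var x)   = refl
  sub-id (ocon c)  = refl
  sub-id (tcon c)  = refl
  sub-id (app t u) = cong₂ app (sub-id t) (sub-id u)
  sub-id (lam A t) = cong₂ lam (sub-id A) (sub-id↑ t)
  sub-id (pi A B)  = cong₂ pi (sub-id A) (sub-id↑ B)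

  sub-id↑ : ∀ t → sub (extS var) t ≡ t
  sub-id↑ t = trans (sub-cong (λ { zero → refl ; (suc x) → refl }) t) (sub-id t)

mutual
  ren-as-sub : ∀ ρ t → ren ρ t ≡ sub (var ∘ ρ) t
  ren-as-sub ρ kind      = refl
  ren-as-sub ρ type      = refl
  ren-as-sub ρ (var x)   = refl
  ren-as-sub ρ (ocon c)  = refl
  ren-as-sub ρ (tcon c)  = refl
  ren-as-sub ρ (app t u) = cong₂ app (ren-as-sub ρ t) (ren-as-sub ρ u)
  ren-as-sub ρ (lam A t) = cong₂ lam (ren-as-sub ρ A) (ren-as-sub↑ ρ t)
  ren-as-sub ρ (pi A B)  = cong₂ pi (ren-as-sub ρ A) (ren-as-sub↑ ρ B)

  ren-as-sub↑ : ∀ ρ t → ren (extR ρ) t ≡ sub (extS (var ∘ ρ)) t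
  ren-as-sub↑ ρ t =
    trans (ren-as-sub (extR ρ) t) (sub-cong (λ { zero → refl ; (suc x) → refl }) t)

ren-id : ∀ t → ren id t ≡ t
ren-id t = trans (ren-as-sub id t) (sub-id t)

sub-single-shift : ∀ a t → shift t [ a ] ≡ t
sub-single-shift a t = trans (sub-ren (single a) suc t) (sub-id t)

_⊕_ : (ℕ → Term) → Term → ℕ → Term
(θ ⊕ a) zero    = a
(θ ⊕ a) (suc n) = θ n

sub-extS-single : ∀ θ a t → sub (extS θ) t [ a ] ≡ sub (θ ⊕ a) t
sub-extS-single θ a t = trans (sub-sub (extS θ) (single a) t)
  (sub-cong (λ { zero → refl ; (suc x) → sub-single-shift a (θ x) }) t)

sub-[] : ∀ θ u v → sub θ (u [ v ]) ≡ sub (extS θ) u [ sub θ v ]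
sub-[] θ u v = trans (sub-sub (single v) θ u)
  (sym (trans (sub-extS-single θ (sub θ v) u) (sub-cong (λ { zero → refl ; (suc x) → refl }) u)))

module Conversion (Γ : GCtx) where
  infix 4 _≈_
  _≈_ : Term → Term → Set
  t ≈ u = Γ ⊢ t ≡βΓ u

  ≈-sym : ∀ {t u} → t ≈ u → u ≈ t
  ≈-sym = EqC.symmetric (Γ ⊢_⟶_)

  ≡⇒≈ : ∀ {t u} → t ≡ u → t ≈ u
  ≡⇒≈ refl = ε

  ⟶⇒≈ : ∀ {t u} → Γ ⊢ t ⟶ u → t ≈ u
  ⟶⇒≈ = EqC.return

  ⟶-sub : ∀ {t t'} θ → Γ ⊢ t ⟶ t' → Γ ⊢ sub θ t ⟶ sub θ t'
  ⟶-sub θ (β {A} {u} {v}) = subst (Γ ⊢ sub θ (app (lam A u) v) ⟶_) (sym (sub-[] θ u v)) β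
  ⟶-sub θ (γ {l} {r} l→r σ) =
    subst₂ (Γ ⊢_⟶_) (sym (sub-sub σ θ l)) (sym (sub-sub σ θ r)) (γ l→r (sub θ ∘ σ))
  ⟶-sub θ (appₗ s) = appₗ (⟶-sub θ s)
  ⟶-sub θ (appᵣ s) = appᵣ (⟶-sub θ s)
  ⟶-sub θ (lamₗ s) = lamₗ (⟶-sub θ s)
  ⟶-sub θ (lamᵣ s) = lamᵣ (⟶-sub (extS θ) s)
  ⟶-sub θ (piₗ s)  = piₗ (⟶-sub θ s)
  ⟶-sub θ (piᵣ s)  = piᵣ (⟶-sub (extS θ) s)

  ≈-sub : ∀ {t t'} θ → t ≈ t' → sub θ t ≈ sub θ t'
  ≈-sub θ = EqC.gmap (sub θ) (⟶-sub θ)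

  ≈-ren : ∀ {t t'} ρ → t ≈ t' → ren ρ t ≈ ren ρ t'
  ≈-ren {t} {t'} ρ t≈t' =
    subst₂ _≈_ (sym (ren-as-sub ρ t)) (sym (ren-as-sub ρ t')) (≈-sub (var ∘ ρ) t≈t')

  rule⇒≈ : ∀ {l r} → rule l r ∈ Γ → l ≈ r
  rule⇒≈ {l} {r} l→r = ⟶⇒≈ (subst₂ (Γ ⊢_⟶_) (sub-id l) (sub-id r) (γ l→r var))

  ≈-app : ∀ {t t' u u'} → t ≈ t' → u ≈ u' → app t u ≈ app t' u'
  ≈-app {t' = t'} {u = u} t≈t' u≈u' =
    EqC.gmap (λ z → app z u) appₗ t≈t' ◅◅ EqC.gmap (app t') appᵣ u≈u'

  ≈-lam : ∀ {t t' u u'} → t ≈ t' → u ≈ u' → lam t u ≈ lam t' u'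
  ≈-lam {t' = t'} {u = u} t≈t' u≈u' =
    EqC.gmap (λ z → lam z u) lamₗ t≈t' ◅◅ EqC.gmap (lam t') lamᵣ u≈u'

  ≈-pi : ∀ {t t' u u'} → t ≈ t' → u ≈ u' → pi t u ≈ pi t' u'
  ≈-pi {t' = t'} {u = u} t≈t' u≈u' =
    EqC.gmap (λ z → pi z u) piₗ t≈t' ◅◅ EqC.gmap (pi t') piᵣ u≈u'

  β-ren-sub : ∀ ρ θ X a → app (ren ρ (sub θ (lam type X))) a ≈ sub ((ren ρ ∘ θ) ⊕ a) X
  β-ren-sub ρ θ X a =
    ⟶⇒≈ β ◅◅ ≡⇒≈ (trans (cong _[ a ] (ren-sub↑ ρ θ X)) (sub-extS-single (ren ρ ∘ θ) a X))

_≗ᵣ_ : ∀ {Ψ Ψ'} → Renₕ Ψ Ψ' → Renₕ Ψ Ψ' → Set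
_≗ᵣ_ {Ψ} r r' = ∀ {A} (x : Ψ ∋ₕ A) → r x ≡ r' x

_≗ₛ_ : ∀ {Ψ Ψ'} → Subₕ Ψ Ψ' → Subₕ Ψ Ψ' → Set
_≗ₛ_ {Ψ} σ σ' = ∀ {A} (x : Ψ ∋ₕ A) → σ x ≡ σ' x

extₕ-cong : ∀ {Ψ Ψ' B} {r r' : Renₕ Ψ Ψ'} → r ≗ᵣ r' → extₕ {B = B} r ≗ᵣ extₕ r'
extₕ-cong h Z     = refl
extₕ-cong h (S x) = cong S (h x)

renₕ-cong : ∀ {Ψ Ψ'} {r r' : Renₕ Ψ Ψ'} → r ≗ᵣ r' → ∀ {A} (t : Tm Ψ A) → renₕ r t ≡ renₕ r' t
renₕ-cong h (` x)   = cong `_ (h x)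
renₕ-cong h (con c) = refl
renₕ-cong h (ƛ t)   = cong ƛ (renₕ-cong (extₕ-cong h) t)
renₕ-cong h (t · u) = cong₂ _·_ (renₕ-cong h t) (renₕ-cong h u)

extsₕ-cong : ∀ {Ψ Ψ' B} {σ σ' : Subₕ Ψ Ψ'} → σ ≗ₛ σ' → extsₕ {B = B} σ ≗ₛ extsₕ σ'
extsₕ-cong h Z     = refl
extsₕ-cong h (S x) = cong (renₕ S) (h x)

subₕ-cong : ∀ {Ψ Ψ'} {σ σ' : Subₕ Ψ Ψ'} → σ ≗ₛ σ' → ∀ {A} (t : Tm Ψ A) → subₕ σ t ≡ subₕ σ' t
subₕ-cong h (` x)   = h x
subₕ-cong h (con c) = refl
subₕ-cong h (ƛ t)   = cong ƛ (subₕ-cong (extsₕ-cong h) t)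
subₕ-cong h (t · u) = cong₂ _·_ (subₕ-cong h t) (subₕ-cong h u)

renₕ-renₕ : ∀ {Ψ Ψ' Ψ''} (r : Renₕ Ψ Ψ') (r' : Renₕ Ψ' Ψ'') {A} (t : Tm Ψ A) →
            renₕ r' (renₕ r t) ≡ renₕ (r' ∘ r) t
renₕ-renₕ r r' (` x)   = refl
renₕ-renₕ r r' (con c) = refl
renₕ-renₕ r r' (ƛ t)   = cong ƛ (trans (renₕ-renₕ (extₕ r) (extₕ r') t)
                                      (renₕ-cong (λ { Z → refl ; (S x) → refl }) t))
renₕ-renₕ r r' (t · u) = cong₂ _·_ (renₕ-renₕ r r' t) (renₕ-renₕ r r' u)

renₕ-shift : ∀ {Ψ Ψ' A B} (r : Renₕ Ψ Ψ') (t : Tm Ψ A) →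
             renₕ (extₕ {B = B} r) (renₕ S t) ≡ renₕ S (renₕ r t)
renₕ-shift r t = trans (renₕ-renₕ S (extₕ r) t) (sym (renₕ-renₕ r S t))

subₕ-renₕ : ∀ {Ψ Ψ' Ψ''} (r : Renₕ Ψ Ψ') (σ : Subₕ Ψ' Ψ'') {A} (t : Tm Ψ A) →
            subₕ σ (renₕ r t) ≡ subₕ (σ ∘ r) t
subₕ-renₕ r σ (` x)   = refl
subₕ-renₕ r σ (con c) = refl
subₕ-renₕ r σ (ƛ t)   = cong ƛ (trans (subₕ-renₕ (extₕ r) (extsₕ σ) t)
                                      (subₕ-cong (λ { Z → refl ; (S x) → refl }) t))
subₕ-renₕ r σ (t · u) = cong₂ _·_ (subₕ-renₕ r σ t) (subₕ-renₕ r σ u)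

renₕ-subₕ : ∀ {Ψ Ψ' Ψ''} (σ : Subₕ Ψ Ψ') (r : Renₕ Ψ' Ψ'') {A} (t : Tm Ψ A) →
            renₕ r (subₕ σ t) ≡ subₕ (renₕ r ∘ σ) t
renₕ-subₕ σ r (` x)   = refl
renₕ-subₕ σ r (con c) = refl
renₕ-subₕ σ r (ƛ t)   = cong ƛ (trans (renₕ-subₕ (extsₕ σ) (extₕ r) t)
                                      (subₕ-cong (λ { Z → refl ; (S x) → renₕ-shift r (σ x) }) t))
renₕ-subₕ σ r (t · u) = cong₂ _·_ (renₕ-subₕ σ r t) (renₕ-subₕ σ r u)

subₕ-shift : ∀ {Ψ Ψ' A B} (σ : Subₕ Ψ Ψ') (t : Tm Ψ A) →
             subₕ (extsₕ {B = B} σ) (renₕ S t) ≡ renₕ S (subₕ σ t)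
subₕ-shift σ t = trans (subₕ-renₕ S (extsₕ σ) t) (sym (renₕ-subₕ σ S t))

subₕ-id : ∀ {Ψ A} (t : Tm Ψ A) → subₕ `_ t ≡ t
subₕ-id (` x)   = refl
subₕ-id (con c) = refl
subₕ-id (ƛ t)   = cong ƛ (trans (subₕ-cong (λ { Z → refl ; (S x) → refl }) t) (subₕ-id t))
subₕ-id (t · u) = cong₂ _·_ (subₕ-id t) (subₕ-id u)

subₕ-single-shift : ∀ {Ψ A B} (a : Tm Ψ B) (t : Tm Ψ A) → subₕ (singleₕ a) (renₕ S t) ≡ t
subₕ-single-shift a t = trans (subₕ-renₕ S (singleₕ a) t) (subₕ-id t)

≡⇒=βη : ∀ {Ψ A} {t u : Tm Ψ A} → t ≡ u → t =βη u
≡⇒=βη refl = ε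

=βη-sym : ∀ {Ψ A} {t u : Tm Ψ A} → t =βη u → u =βη t
=βη-sym = EqC.symmetric _⟶βη_

=βη-· : ∀ {Ψ A B} {t t' : Tm Ψ (A ⇒ B)} {u u'} → t =βη t' → u =βη u' → (t · u) =βη (t' · u')
=βη-· {t' = t'} {u = u} t=t' u=u' =
  EqC.gmap (_· u) ξ-·₁ t=t' ◅◅ EqC.gmap (t' ·_) ξ-·₂ u=u'

=βη-ƛ : ∀ {Ψ A B} {t t' : Tm (A ∷ Ψ) B} → t =βη t' → ƛ t =βη ƛ t'
=βη-ƛ = EqC.gmap ƛ ξ-ƛ

mutual
  renₕ-Ne : ∀ {Ψ Ψ'} (r : Renₕ Ψ Ψ') {A} {t : Tm Ψ A} → Ne t → Ne (renₕ r t)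
  renₕ-Ne r ne-var       = ne-var
  renₕ-Ne r ne-con       = ne-con
  renₕ-Ne r (ne-app n m) = ne-app (renₕ-Ne r n) (renₕ-Nf r m)

  renₕ-Nf : ∀ {Ψ Ψ'} (r : Renₕ Ψ Ψ') {A} {t : Tm Ψ A} → Nf t → Nf (renₕ r t)
  renₕ-Nf r (nf-ƛ n)  = nf-ƛ (renₕ-Nf (extₕ r) n)
  renₕ-Nf r (nf-ne n) = nf-ne (renₕ-Ne r n)

-- Binder types are irrelevant since decoding is only used
-- up to ≡βΓ.
Dapp Dlam Dpi : Term
Dapp = lam type (lam type (app (var 1) (var 0)))
Dlam = lam type (lam type (lam (var 1) (app (var 1) (var 0))))
Dpi  = lam type (lam type (pi (var 1) (app (var 1) (var 0))))

decodeCon : ∀ {A} → HCon A → Term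
decodeCon cType    = type
decodeCon cKind    = kind
decodeCon cApp     = Dapp
decodeCon cLam     = Dlam
decodeCon cPi      = Dpi
decodeCon (cObj c) = ocon c
decodeCon (cTyp C) = tcon C

decode : ∀ {Ψ A} → Tm Ψ A → Term
decode (` x)   = var (∋-index x)
decode (con c) = decodeCon c
decode (ƛ t)   = lam type (decode t)
decode (t · u) = app (decode t) (decode u)

-- The λΠ-renaming induced by an HRS-renaming (indices beyond the context are
-- shifted so that lifting under a binder is respected).
toRen : ∀ {Ψ Ψ'} → Renₕ Ψ Ψ' → ℕ → ℕ
toRen {[]}    {Ψ'} r n       = length Ψ' + n
toRen {A ∷ Ψ}      r zero    = ∋-index (r Z)
toRen {A ∷ Ψ}      r (suc n) = toRen (r ∘ S) n

toRen-index : ∀ {Ψ Ψ'} (r : Renₕ Ψ Ψ') {A} (x : Ψ ∋ₕ A) → ∋-index (r x) ≡ toRen r (∋-index x)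
toRen-index r Z     = refl
toRen-index r (S x) = toRen-index (r ∘ S) x

toRen-S∘ : ∀ {Ψ Ψ' B} (r : Renₕ Ψ Ψ') → toRen {Ψ} {B ∷ Ψ'} (S ∘ r) ≗ suc ∘ toRen r
toRen-S∘ {[]}    r n       = refl
toRen-S∘ {A ∷ Ψ} r zero    = refl
toRen-S∘ {A ∷ Ψ} r (suc n) = toRen-S∘ (r ∘ S) n

toRen-S : ∀ {Ψ B} → toRen {Ψ} {B ∷ Ψ} S ≗ suc
toRen-S {Ψ} n = trans (toRen-S∘ {Ψ} id n) (cong suc (toRen-id {Ψ} n))
  where
  toRen-id : ∀ {Ψ} → toRen {Ψ} {Ψ} id ≗ id
  toRen-id {[]}    n       = refl
  toRen-id {A ∷ Ψ} zero    = refl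
  toRen-id {A ∷ Ψ} (suc n) = trans (toRen-S∘ {Ψ} id n) (cong suc (toRen-id {Ψ} n))

decodeCon-closed : ∀ {A} (c : HCon A) θ → sub θ (decodeCon c) ≡ decodeCon c
decodeCon-closed cType    θ = refl
decodeCon-closed cKind    θ = refl
decodeCon-closed cApp     θ = refl
decodeCon-closed cLam     θ = refl
decodeCon-closed cPi      θ = refl
decodeCon-closed (cObj c) θ = refl
decodeCon-closed (cTyp C) θ = refl

decode-ren : ∀ {Ψ Ψ'} (r : Renₕ Ψ Ψ') {A} (t : Tm Ψ A) →
             decode (renₕ r t) ≡ ren (toRen r) (decode t)
decode-ren r (` x)   = cong var (toRen-index r x)
decode-ren r (con c) = sym (trans (ren-as-sub (toRen r) (decodeCon c)) (decodeCon-closed c _))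
decode-ren r (ƛ t)   = cong (lam type) (trans (decode-ren (extₕ r) t)
  (ren-cong (λ { zero → refl ; (suc n) → toRen-S∘ r n }) (decode t)))
decode-ren r (t · u) = cong₂ app (decode-ren r t) (decode-ren r u)

decode-shift : ∀ {Ψ A B} (t : Tm Ψ A) → decode (renₕ (S {B = B}) t) ≡ shift (decode t)
decode-shift {Ψ} t = trans (decode-ren S t) (ren-cong (toRen-S {Ψ}) (decode t))

toSub : ∀ {Ψ Ψ'} → Subₕ Ψ Ψ' → ℕ → Term
toSub {[]}    {Ψ'} σ n       = var (length Ψ' + n)
toSub {A ∷ Ψ}      σ zero    = decode (σ Z)
toSub {A ∷ Ψ}      σ (suc n) = toSub (σ ∘ S) n

toSub-index : ∀ {Ψ Ψ'} (σ : Subₕ Ψ Ψ') {A} (x : Ψ ∋ₕ A) → toSub σ (∋-index x) ≡ decode (σ x)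
toSub-index σ Z     = refl
toSub-index σ (S x) = toSub-index (σ ∘ S) x

toSub-wk : ∀ {Ψ Ψ' B} (σ : Subₕ Ψ Ψ') → toSub {Ψ} {B ∷ Ψ'} (renₕ S ∘ σ) ≗ shift ∘ toSub σ
toSub-wk {[]}    σ n       = refl
toSub-wk {A ∷ Ψ} σ zero    = decode-shift (σ Z)
toSub-wk {A ∷ Ψ} σ (suc n) = toSub-wk (σ ∘ S) n

decode-sub : ∀ {Ψ Ψ'} (σ : Subₕ Ψ Ψ') {A} (t : Tm Ψ A) →
             decode (subₕ σ t) ≡ sub (toSub σ) (decode t)
decode-sub σ (` x)   = sym (toSub-index σ x)
decode-sub σ (con c) = sym (decodeCon-closed c (toSub σ))
decode-sub σ (ƛ t)   = cong (lam type) (trans (decode-sub (extsₕ σ) t)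
  (sub-cong (λ { zero → refl ; (suc n) → toSub-wk σ n }) (decode t)))
decode-sub σ (t · u) = cong₂ app (decode-sub σ t) (decode-sub σ u)

-- It is a partial
-- equivalence relation relating the decodings of βη-convertible terms under
-- related substitutions, i.e. decoding turns =βη into ≡βΓ; as the two sides
-- of each rule of HRS(βΓ) decode to convertible terms, it also turns
-- HRS(βΓ)-reduction into ≡βΓ.
module KripkeModel (Γ : GCtx) where
  open Conversion Γ

  Rel : Ty → Term → Term → Set
  Rel ι       t t' = t ≈ t'
  Rel (A ⇒ B) f f' = ∀ ρ {a a'} → Rel A a a' → Rel B (app (ren ρ f) a) (app (ren ρ f') a')

  Rel-sym : ∀ A {t t'} → Rel A t t' → Rel A t' t
  Rel-sym ι       t∼t'        = ≈-sym t∼t'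
  Rel-sym (A ⇒ B) f∼f' ρ a∼a' = Rel-sym B (f∼f' ρ (Rel-sym A a∼a'))

  Rel-trans : ∀ A {t u v} → Rel A t u → Rel A u v → Rel A t v
  Rel-trans ι       t∼u u∼v        = t∼u ◅◅ u∼v
  Rel-trans (A ⇒ B) f∼g g∼h ρ a∼a' =
    Rel-trans B (f∼g ρ a∼a') (g∼h ρ (Rel-trans A (Rel-sym A a∼a') a∼a'))

  Rel-convˡ : ∀ A {t s u} → t ≈ s → Rel A s u → Rel A t u
  Rel-convˡ ι       t≈s s∼u        = t≈s ◅◅ s∼u
  Rel-convˡ (A ⇒ B) t≈s s∼u ρ a∼a' = Rel-convˡ B (≈-app (≈-ren ρ t≈s) ε) (s∼u ρ a∼a')

  Rel-convʳ : ∀ A {t s u} → Rel A t s → s ≈ u → Rel A t u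
  Rel-convʳ A t∼s s≈u = Rel-sym A (Rel-convˡ A (≈-sym s≈u) (Rel-sym A t∼s))

  Rel-ren : ∀ A {t t'} ρ → Rel A t t' → Rel A (ren ρ t) (ren ρ t')
  Rel-ren ι       ρ t∼t' = ≈-ren ρ t∼t'
  Rel-ren (A ⇒ B) {f} {f'} ρ f∼f' ρ' {a} {a'} a∼a' =
    subst₂ (Rel B) (cong (λ g → app g a) (sym (ren-ren ρ ρ' f)))
                   (cong (λ g → app g a') (sym (ren-ren ρ ρ' f')))
      (f∼f' (ρ' ∘ ρ) a∼a')

  Rel-app : ∀ {A B f f' a a'} → Rel (A ⇒ B) f f' → Rel A a a' → Rel B (app f a) (app f' a')
  Rel-app {B = B} {f} {f'} {a} {a'} f∼f' a∼a' =
    subst₂ (Rel B) (cong (λ g → app g a) (ren-id f)) (cong (λ g → app g a') (ren-id f'))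
      (f∼f' id a∼a')

  record RelS (Ψ : HCtx) (θ θ' : ℕ → Term) : Set where
    constructor relS
    field at : ∀ {A} (x : Ψ ∋ₕ A) → Rel A (θ (∋-index x)) (θ' (∋-index x))
  open RelS

  RelS-sym : ∀ {Ψ θ θ'} → RelS Ψ θ θ' → RelS Ψ θ' θ
  RelS-sym θ∼θ' = relS λ {A} x → Rel-sym A (at θ∼θ' x)

  RelS-refl : ∀ {Ψ θ θ'} → RelS Ψ θ θ' → RelS Ψ θ' θ'
  RelS-refl θ∼θ' = relS λ {A} x → Rel-trans A (Rel-sym A (at θ∼θ' x)) (at θ∼θ' x)

  RelS-ext : ∀ {Ψ A θ θ' a a'} ρ → RelS Ψ θ θ' → Rel A a a' →
             RelS (A ∷ Ψ) ((ren ρ ∘ θ) ⊕ a) ((ren ρ ∘ θ') ⊕ a')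
  RelS-ext ρ θ∼θ' a∼a' = relS λ { Z → a∼a' ; {C} (S x) → Rel-ren C ρ (at θ∼θ' x) }

  Rel-lam : ∀ {Ψ A B θ θ'} X Y →
            (∀ {φ φ'} → RelS (A ∷ Ψ) φ φ' → Rel B (sub φ X) (sub φ' Y)) →
            RelS Ψ θ θ' → Rel (A ⇒ B) (sub θ (lam type X)) (sub θ' (lam type Y))
  Rel-lam {B = B} {θ} {θ'} X Y body θ∼θ' ρ {a} {a'} a∼a' =
    Rel-convˡ B (β-ren-sub ρ θ X a)
      (Rel-convʳ B (body (RelS-ext ρ θ∼θ' a∼a')) (≈-sym (β-ren-sub ρ θ' Y a')))

  Dapp-β : ∀ X Y → app (app Dapp X) Y ≈ app X Y
  Dapp-β X Y = ⟶⇒≈ (appₗ β) ◅◅ ⟶⇒≈ β ◅◅ ≡⇒≈ (cong (λ Z → app Z Y) (sub-single-shift Y X))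

  Dlam-β : ∀ X F → app (app Dlam X) F ≈ lam X (app (shift F) (var 0))
  Dlam-β X F = ⟶⇒≈ (appₗ β) ◅◅ ⟶⇒≈ β ◅◅
    ≡⇒≈ (cong (λ Z → lam Z (app (shift F) (var 0))) (sub-single-shift F X))

  Dpi-β : ∀ X F → app (app Dpi X) F ≈ pi X (app (shift F) (var 0))
  Dpi-β X F = ⟶⇒≈ (appₗ β) ◅◅ ⟶⇒≈ β ◅◅
    ≡⇒≈ (cong (λ Z → pi Z (app (shift F) (var 0))) (sub-single-shift F X))

  Dbody-β : ∀ X → app (shift (lam type X)) (var 0) ≈ X
  Dbody-β X = ⟶⇒≈ β ◅◅ ≡⇒≈ (trans (sub-ren (single (var 0)) (extR suc) X)
    (trans (sub-cong (λ { zero → refl ; (suc n) → refl }) X) (sub-id X)))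

  Rel-con : ∀ {A} (c : HCon A) θ θ' → Rel A (sub θ (decodeCon c)) (sub θ' (decodeCon c))
  Rel-con cType    θ θ' = ε
  Rel-con cKind    θ θ' = ε
  Rel-con (cObj c) θ θ' = ε
  Rel-con (cTyp C) θ θ' = ε
  Rel-con cApp θ θ' ρ {a} {a'} a≈a' ρ' {b} {b'} b≈b' =
    Dapp-β (ren ρ' a) b ◅◅ ≈-app (≈-ren ρ' a≈a') b≈b' ◅◅ ≈-sym (Dapp-β (ren ρ' a') b')
  Rel-con cLam θ θ' ρ {a} {a'} a≈a' ρ' {b} {b'} b∼b' =
    Dlam-β (ren ρ' a) b ◅◅ ≈-lam (≈-ren ρ' a≈a') (b∼b' suc ε) ◅◅ ≈-sym (Dlam-β (ren ρ' a') b')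
  Rel-con cPi θ θ' ρ {a} {a'} a≈a' ρ' {b} {b'} b∼b' =
    Dpi-β (ren ρ' a) b ◅◅ ≈-pi (≈-ren ρ' a≈a') (b∼b' suc ε) ◅◅ ≈-sym (Dpi-β (ren ρ' a') b')

  fundamental : ∀ {Ψ A θ θ'} (t : Tm Ψ A) → RelS Ψ θ θ' → Rel A (sub θ (decode t)) (sub θ' (decode t))
  fundamental (` x)   θ∼θ' = at θ∼θ' x
  fundamental (con c) θ∼θ' = Rel-con c _ _
  fundamental (ƛ t)   θ∼θ' = Rel-lam (decode t) (decode t) (fundamental t) θ∼θ'
  fundamental (t · u) θ∼θ' = Rel-app (fundamental t θ∼θ') (fundamental u θ∼θ')

  ⟶βη-sound : ∀ {Ψ A θ θ'} {t t' : Tm Ψ A} → t ⟶βη t' → RelS Ψ θ θ' →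
              Rel A (sub θ (decode t)) (sub θ' (decode t'))
  ⟶βη-sound {Ψ} {A} {θ} {θ'} (β-ƛ {t = t} {u = u}) θ∼θ' =
    Rel-convˡ A (⟶⇒≈ β ◅◅ ≡⇒≈ (sub-extS-single θ (sub θ (decode u)) (decode t)))
      (subst (Rel A _) (sym decoded-reduct) (fundamental t θ⊕u∼))
    where
    decoded-reduct : sub θ' (decode (subₕ (singleₕ u) t)) ≡ sub (sub θ' ∘ toSub (singleₕ u)) (decode t)
    decoded-reduct = trans (cong (sub θ') (decode-sub (singleₕ u) t)) (sub-sub _ θ' (decode t))

    θ⊕u∼ : RelS (_ ∷ Ψ) (θ ⊕ sub θ (decode u)) (sub θ' ∘ toSub (singleₕ u))
    θ⊕u∼ = relS λ
      { Z → fundamental u θ∼θ'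
      ; {C} (S x) → subst (Rel C (θ (∋-index x)))
                          (cong (sub θ') (sym (toSub-index (singleₕ u ∘ S) x))) (at θ∼θ' x) }
  ⟶βη-sound {θ = θ} (η-ƛ {A} {B} {t}) θ∼θ' ρ {a} a∼a' =
    Rel-convˡ B (β-ren-sub ρ θ (app (decode (renₕ S t)) (var 0)) a ◅◅ ≡⇒≈ η-reduct)
      (fundamental t θ∼θ' ρ a∼a')
    where
    open ≡-Reasoning
    η-reduct : sub ((ren ρ ∘ θ) ⊕ a) (app (decode (renₕ S t)) (var 0)) ≡ app (ren ρ (sub θ (decode t))) a
    η-reduct = cong (λ Z → app Z a) (begin
      sub ((ren ρ ∘ θ) ⊕ a) (decode (renₕ S t))    ≡⟨ cong (sub _) (decode-shift t) ⟩
      sub ((ren ρ ∘ θ) ⊕ a) (shift (decode t))     ≡⟨ sub-ren _ suc (decode t) ⟩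
      sub (ren ρ ∘ θ) (decode t)                   ≡⟨ sym (ren-sub ρ θ (decode t)) ⟩
      ren ρ (sub θ (decode t))                     ∎)
  ⟶βη-sound (ξ-ƛ {t = t} {t'} s) θ∼θ' = Rel-lam (decode t) (decode t') (⟶βη-sound s) θ∼θ'
  ⟶βη-sound (ξ-·₁ {u = u} s)    θ∼θ' = Rel-app (⟶βη-sound s θ∼θ') (fundamental u θ∼θ')
  ⟶βη-sound (ξ-·₂ {t = t} s)    θ∼θ' = Rel-app (fundamental t θ∼θ') (⟶βη-sound s θ∼θ')

  =βη-sound : ∀ {Ψ A θ θ'} {t t' : Tm Ψ A} → t =βη t' → RelS Ψ θ θ' →
              Rel A (sub θ (decode t)) (sub θ' (decode t'))
  =βη-sound {t = t} ε θ∼θ' = fundamental t θ∼θ'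
  =βη-sound {A = A} (fwd s ◅ ss) θ∼θ' =
    Rel-trans A (⟶βη-sound s θ∼θ') (=βη-sound ss (RelS-refl θ∼θ'))
  =βη-sound {A = A} (bwd s ◅ ss) θ∼θ' =
    Rel-trans A (Rel-sym A (⟶βη-sound s (RelS-sym θ∼θ'))) (=βη-sound ss (RelS-refl θ∼θ'))

  index-meta : ∀ {Φ A} k (x : Φ ∋ₕ A) → ∋-index (metaₕ k x) ≡ k + ∋-index x
  index-meta zero    x = refl
  index-meta (suc k) x = cong suc (index-meta k x)

  index-bvar : ∀ {Φ} k (i : Fin k) → ∋-index (bvarₕ {Φ} k i) ≡ toℕ i
  index-bvar (suc k) fz     = refl
  index-bvar (suc k) (fs i) = cong suc (index-bvar k i)

  mutual
    decode-Enc : ∀ {Φ k t e} → Enc Φ k t e → decode e ≈ t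
    decode-Enc e-kind = ε
    decode-Enc e-type = ε
    decode-Enc e-ocon = ε
    decode-Enc e-tcon = ε
    decode-Enc {Φ} {k} (e-bvar i) = ≡⇒≈ (cong var (index-bvar {Φ} k i))
    decode-Enc (e-lam {a = a} {b = b} A↦a t↦b) = Dlam-β (decode a) (lam type (decode b)) ◅◅
      ≈-lam (decode-Enc A↦a) (Dbody-β (decode b) ◅◅ decode-Enc t↦b)
    decode-Enc (e-pi {a = a} {b = b} A↦a B↦b) = Dpi-β (decode a) (lam type (decode b)) ◅◅
      ≈-pi (decode-Enc A↦a) (Dbody-β (decode b) ◅◅ decode-Enc B↦b)
    decode-Enc {k = k} (e-fvar x vs↦as) = decode-EncArgs vs↦as (≡⇒≈ (cong var (index-meta k x)))
    decode-Enc (e-app {a = a} {b = b} _ t↦a u↦b) =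
      Dapp-β (decode a) (decode b) ◅◅ ≈-app (decode-Enc t↦a) (decode-Enc u↦b)

    decode-EncArgs : ∀ {Φ k n} {vs : Vec Term n} {as} → EncArgs Φ k vs as →
                     ∀ {f F} → decode f ≈ F → decode (applyN f as) ≈ apps F vs
    decode-EncArgs ea-nil                 f≈F = f≈F
    decode-EncArgs (ea-cons v↦a vs↦as) f≈F = decode-EncArgs vs↦as (≈-app f≈F (decode-Enc v↦a))

  decode-rule : ∀ {ρ} → HRS-βΓ Γ ρ → decode (lhs ρ) ≈ decode (rhs ρ)
  decode-rule (inj₁ refl) =
    Dapp-β _ (var 2) ◅◅ ≈-app (Dlam-β (var 0) (lam type (app (var 2) (var 0)))) ε ◅◅
    ⟶⇒≈ β ◅◅ ⟶⇒≈ β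
  decode-rule (inj₂ (l , r , l→r , l↦ , r↦)) =
    decode-Enc l↦ ◅◅ rule⇒≈ l→r ◅◅ ≈-sym (decode-Enc r↦)

  Step-sound : ∀ {Ψ A θ θ'} {s s' : Tm Ψ A} → Step (HRS-βΓ Γ) s s' → RelS Ψ θ θ' →
               Rel A (sub θ (decode s)) (sub θ' (decode s'))
  Step-sound {θ' = θ'} (root {ρ} ρ∈R σ (_ , u=l) (_ , v=r)) θ∼θ' =
    =βη-sound u=l θ∼θ' ◅◅ ≈-sub θ' instance-conv ◅◅ =βη-sound (=βη-sym v=r) (RelS-refl θ∼θ')
    where
    instance-conv : decode (subₕ σ (lhs ρ)) ≈ decode (subₕ σ (rhs ρ))
    instance-conv = subst₂ _≈_ (sym (decode-sub σ (lhs ρ))) (sym (decode-sub σ (rhs ρ)))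
                      (≈-sub (toSub σ) (decode-rule ρ∈R))
  Step-sound (ξ-ƛ {t = t} {t'} s) θ∼θ' = Rel-lam (decode t) (decode t') (Step-sound s) θ∼θ'
  Step-sound (ξ-·₁ {u = u} s)    θ∼θ' = Rel-app (Step-sound s θ∼θ') (fundamental u θ∼θ')
  Step-sound (ξ-·₂ {t = t} s)    θ∼θ' = Rel-app (fundamental t θ∼θ') (Step-sound s θ∼θ')

  Steps-sound : ∀ {Ψ A θ θ'} {s s' : Tm Ψ A} → Star (Step (HRS-βΓ Γ)) s s' → RelS Ψ θ θ' →
                Rel A (sub θ (decode s)) (sub θ' (decode s'))
  Steps-sound {s = s} ε θ∼θ' = fundamental s θ∼θ'
  Steps-sound {A = A} (x ◅ xs) θ∼θ' =
    Rel-trans A (Step-sound x θ∼θ') (Steps-sound xs (RelS-refl θ∼θ'))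

  decode-sound : ∀ n {s s' : Tm (replicate n ι) ι} → Star (Step (HRS-βΓ Γ)) s s' → decode s ≈ decode s'
  decode-sound n {s} {s'} s↠s' =
    subst₂ _≈_ (sub-id (decode s)) (sub-id (decode s')) (Steps-sound s↠s' (relS vars-related))
    where
    first-order : ∀ {n A} → replicate n ι ∋ₕ A → A ≡ ι
    first-order {suc n} Z     = refl
    first-order {suc n} (S x) = first-order x

    vars-related : ∀ {A} (x : replicate n ι ∋ₕ A) → Rel A (var (∋-index x)) (var (∋-index x))
    vars-related x = subst (λ A → Rel A (var (∋-index x)) (var (∋-index x))) (sym (first-order x)) ε

data ConstHead : Term → Set where
  ch-ocon : ∀ {c} → ConstHead (ocon c)
  ch-tcon : ∀ {C} → ConstHead (tcon C)
  ch-app  : ∀ {t u} → ConstHead t → ConstHead (app t u)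

Pat-ConstHead : ∀ {ar t} → Pat 0 ar t → ConstHead t
Pat-ConstHead p-ocon             = ch-ocon
Pat-ConstHead p-tcon             = ch-tcon
Pat-ConstHead (p-app p q)        = ch-app (Pat-ConstHead p)
Pat-ConstHead (p-fvar p _ _ _ _) = ch-app (Pat-ConstHead p)
Pat-ConstHead (p-lam p _ q)      = ch-app (Pat-ConstHead p)

apps-ConstHead : ∀ {n h} (vs : Vec Term n) → ConstHead (apps h vs) → ConstHead h
apps-ConstHead []       h-const = h-const
apps-ConstHead (v ∷ vs) hv-const with apps-ConstHead vs hv-const
... | ch-app h-const = h-const

-- A Boolean model of the simply typed λ-calculus detecting the constant pi
-- in head position: pi is interpreted as "true", every other constant as
-- "false".  Values of function type are compared extensionally (a logical
-- partial equivalence), so evaluation respects =βη without function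
-- extensionality.
module PiDetector where
  Val : Ty → Set
  Val ι       = Bool
  Val (A ⇒ B) = Val A → Val B

  Eqv : ∀ A → Val A → Val A → Set
  Eqv ι       x y = x ≡ y
  Eqv (A ⇒ B) f g = ∀ {x y} → Eqv A x y → Eqv B (f x) (g y)

  Eqv-sym : ∀ A {x y} → Eqv A x y → Eqv A y x
  Eqv-sym ι       x≡y = sym x≡y
  Eqv-sym (A ⇒ B) f≋g x≋y = Eqv-sym B (f≋g (Eqv-sym A x≋y))

  Eqv-trans : ∀ A {x y z} → Eqv A x y → Eqv A y z → Eqv A x z
  Eqv-trans ι       x≡y y≡z = trans x≡y y≡z
  Eqv-trans (A ⇒ B) f≋g g≋h x≋y = Eqv-trans B (f≋g x≋y) (g≋h (Eqv-trans A (Eqv-sym A x≋y) x≋y))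

  Eqv-reflˡ : ∀ A {x y} → Eqv A x y → Eqv A x x
  Eqv-reflˡ A x≋y = Eqv-trans A x≋y (Eqv-sym A x≋y)

  Env : HCtx → Set
  Env Ψ = ∀ {A} → Ψ ∋ₕ A → Val A

  _∷ₑ_ : ∀ {Ψ A} → Val A → Env Ψ → Env (A ∷ Ψ)
  (a ∷ₑ η) Z     = a
  (a ∷ₑ η) (S x) = η x

  EnvEqv : ∀ Ψ → Env Ψ → Env Ψ → Set
  EnvEqv Ψ η η' = ∀ {A} (x : Ψ ∋ₕ A) → Eqv A (η x) (η' x)

  EnvEqv-∷ : ∀ {Ψ A} {η η' : Env Ψ} {a b} → EnvEqv Ψ η η' → Eqv A a b → EnvEqv (A ∷ Ψ) (a ∷ₑ η) (b ∷ₑ η')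
  EnvEqv-∷ η≋η' a≋b Z     = a≋b
  EnvEqv-∷ η≋η' a≋b (S x) = η≋η' x

  isPi : ∀ {A} → HCon A → Val A
  isPi cPi      = λ _ _ → true
  isPi cApp     = λ _ _ → false
  isPi cLam     = λ _ _ → false
  isPi cType    = false
  isPi cKind    = false
  isPi (cObj _) = false
  isPi (cTyp _) = false

  isPi-eqv : ∀ {A} (c : HCon A) → Eqv A (isPi c) (isPi c)
  isPi-eqv cPi      _ _ = refl
  isPi-eqv cApp     _ _ = refl
  isPi-eqv cLam     _ _ = refl
  isPi-eqv cType        = refl
  isPi-eqv cKind        = refl
  isPi-eqv (cObj _)     = refl
  isPi-eqv (cTyp _)     = refl

  eval : ∀ {Ψ A} → Tm Ψ A → Env Ψ → Val A
  eval (` x)   η = η x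
  eval (con c) η = isPi c
  eval (ƛ t)   η = λ a → eval t (a ∷ₑ η)
  eval (t · u) η = eval t η (eval u η)

  eval-eqv : ∀ {Ψ A} {η η' : Env Ψ} (t : Tm Ψ A) → EnvEqv Ψ η η' → Eqv A (eval t η) (eval t η')
  eval-eqv (` x)   η≋η'     = η≋η' x
  eval-eqv (con c) η≋η'     = isPi-eqv c
  eval-eqv (ƛ t)   η≋η' a≋b = eval-eqv t (EnvEqv-∷ η≋η' a≋b)
  eval-eqv (t · u) η≋η'     = eval-eqv t η≋η' (eval-eqv u η≋η')

  eval-ren : ∀ {Ψ Ψ' A} (r : Renₕ Ψ Ψ') (t : Tm Ψ A) {η : Env Ψ'} {η' : Env Ψ} →
             (∀ {B} (x : Ψ ∋ₕ B) → Eqv B (η (r x)) (η' x)) → Eqv A (eval (renₕ r t) η) (eval t η')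
  eval-ren r (` x)   η∘r≋η'     = η∘r≋η' x
  eval-ren r (con c) η∘r≋η'     = isPi-eqv c
  eval-ren r (ƛ t)   η∘r≋η' a≋b = eval-ren (extₕ r) t (λ { Z → a≋b ; (S x) → η∘r≋η' x })
  eval-ren r (t · u) η∘r≋η'     = eval-ren r t η∘r≋η' (eval-ren r u η∘r≋η')

  eval-sub : ∀ {Ψ Ψ' A} (σ : Subₕ Ψ Ψ') (t : Tm Ψ A) {η : Env Ψ'} {η' : Env Ψ} → EnvEqv Ψ' η η →
             (∀ {B} (x : Ψ ∋ₕ B) → Eqv B (eval (σ x) η) (η' x)) → Eqv A (eval (subₕ σ t) η) (eval t η')
  eval-sub σ (` x)   η≋η η∘σ≋η' = η∘σ≋η' x
  eval-sub σ (con c) η≋η η∘σ≋η' = isPi-eqv c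
  eval-sub σ (ƛ {A = A} t) {η} η≋η η∘σ≋η' {a} a≋b =
    eval-sub (extsₕ σ) t (EnvEqv-∷ η≋η (Eqv-reflˡ A a≋b)) λ
      { Z → a≋b
      ; {B} (S x) → Eqv-trans B (eval-ren S (σ x) {a ∷ₑ η} {η} η≋η) (η∘σ≋η' x) }
  eval-sub σ (t · u) η≋η η∘σ≋η' = eval-sub σ t η≋η η∘σ≋η' (eval-sub σ u η≋η η∘σ≋η')

  eval-⟶βη : ∀ {Ψ A} {η η' : Env Ψ} {t t' : Tm Ψ A} → t ⟶βη t' → EnvEqv Ψ η η' →
             Eqv A (eval t η) (eval t' η')
  eval-⟶βη {Ψ} {A} {η} {η'} (β-ƛ {t = t} {u = u}) η≋η' =
    Eqv-trans A (eval-eqv t (EnvEqv-∷ η≋η' (eval-eqv u η≋η')))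
      (Eqv-sym A (eval-sub (singleₕ u) t η'≋η' (λ { Z → eval-eqv u η'≋η' ; (S x) → η'≋η' x })))
    where
    η'≋η' : EnvEqv Ψ η' η'
    η'≋η' {B} x = Eqv-reflˡ B (Eqv-sym B (η≋η' x))
  eval-⟶βη {A = A ⇒ B} {η} (η-ƛ {t = t}) η≋η' {a} a≋b =
    Eqv-trans B (eval-ren S t {a ∷ₑ η} {η} (λ {C} x → Eqv-reflˡ C (η≋η' x)) a≋b)
                (eval-eqv t η≋η' (Eqv-trans A (Eqv-sym A a≋b) a≋b))
  eval-⟶βη (ξ-ƛ s)            η≋η' a≋b = eval-⟶βη s (EnvEqv-∷ η≋η' a≋b)
  eval-⟶βη (ξ-·₁ {u = u} s) η≋η'     = eval-⟶βη s η≋η' (eval-eqv u η≋η')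
  eval-⟶βη (ξ-·₂ {t = t} s) η≋η'     = eval-eqv t η≋η' (eval-⟶βη s η≋η')

  eval-=βη : ∀ {Ψ A} {η : Env Ψ} {t t' : Tm Ψ A} → t =βη t' → EnvEqv Ψ η η → Eqv A (eval t η) (eval t' η)
  eval-=βη {t = t} ε              η≋η = eval-eqv t η≋η
  eval-=βη {A = A} (fwd s ◅ ss) η≋η = Eqv-trans A (eval-⟶βη s η≋η) (eval-=βη ss η≋η)
  eval-=βη {A = A} (bwd s ◅ ss) η≋η = Eqv-trans A (Eqv-sym A (eval-⟶βη s η≋η)) (eval-=βη ss η≋η)

  falseVal : ∀ A → Val A
  falseVal ι       = false
  falseVal (A ⇒ B) = λ _ → falseVal B

  falseVal-eqv : ∀ A → Eqv A (falseVal A) (falseVal A)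
  falseVal-eqv ι         = refl
  falseVal-eqv (A ⇒ B) _ = falseVal-eqv B

  falseEnv : ∀ {Ψ} → Env Ψ
  falseEnv {A = A} _ = falseVal A

  falseEnv-eqv : ∀ {Ψ} → EnvEqv Ψ falseEnv falseEnv
  falseEnv-eqv {A = A} _ = falseVal-eqv A

  -- The encoding of a constant-headed term is an application node, and so
  -- it is not detected as a product.
  eval-Enc : ∀ {Φ k t e} → Enc Φ k t e → ConstHead t →
             (η : Env (replicate k ι ++ Φ)) → eval e η ≡ false
  eval-Enc e-ocon         _       η = refl
  eval-Enc e-tcon         _       η = refl
  eval-Enc (e-app _ _ _)  _       η = refl
  eval-Enc (e-fvar x {vs} _) t-const η with apps-ConstHead vs t-const
  ... | ()
  eval-Enc e-kind         ()      η
  eval-Enc e-type         ()      η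
  eval-Enc (e-bvar i)     ()      η
  eval-Enc (e-lam _ _)    ()      η
  eval-Enc (e-pi _ _)     ()      η

Joinable : (HRule → Set) → ∀ {Ψ A} → Tm Ψ A → Tm Ψ A → Set
Joinable R {Ψ} {A} s t = Σ (Tm Ψ A) λ w → Star (Step R) s w × Star (Step R) t w

-- The left-hand side of every rule of
-- HRS(βΓ) is headed by app or by (the encoding of) a constant, so no rule
-- applies at the root of  pi(a, λx.b)  and reduction happens inside a and b.
module ProductReducts (Γ : GCtx) (conds : ∀ u v → rule u v ∈ Γ → EncodingConditions u v) where
  open PiDetector

  R : HRule → Set
  R = HRS-βΓ Γ

  -- A product is never βη-equal to an instance of a left-hand side: the
  -- former evaluates to true, the latter to false.
  no-root-pi : ∀ {Ψ ρ} {σ : Subₕ (ctx ρ) Ψ} {a b} → R ρ →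
               IsNFOf (con cPi · a · ƛ b) (subₕ σ (lhs ρ)) → ⊥
  no-root-pi {ρ = ρ} {σ} ρ∈R (_ , pi=lσ) = true≢false
    (trans (eval-=βη pi=lσ falseEnv-eqv)
      (trans (eval-sub σ (lhs ρ) falseEnv-eqv (λ x → eval-eqv (σ x) falseEnv-eqv)) (lhs-false ρ∈R)))
    where
    true≢false : true ≡ false → ⊥
    true≢false ()

    lhs-false : R ρ → eval (lhs ρ) (λ x → eval (σ x) falseEnv) ≡ false
    lhs-false (inj₁ refl)                  = refl
    lhs-false (inj₂ (l , r , l→r , l↦ , _)) =
      eval-Enc l↦ (Pat-ConstHead (proj₂ (proj₁ (conds l r l→r)))) _

  pi-reducts : ∀ {Ψ} {a : Tm Ψ ι} {b : Tm (ι ∷ Ψ) ι} {w} → Star (Step R) (con cPi · a · ƛ b) w →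
               Σ (Tm Ψ ι) λ a' → Σ (Tm (ι ∷ Ψ) ι) λ b' →
                 w ≡ con cPi · a' · ƛ b' × Star (Step R) a a' × Star (Step R) b b'
  pi-reducts {a = a} {b} ε          = a , b , refl , ε , ε
  pi-reducts (root ρ∈R σ nf _ ◅ _) = ⊥-elim (no-root-pi ρ∈R nf)
  pi-reducts (ξ-·₁ (ξ-·₁ ()) ◅ _)
  pi-reducts (ξ-·₁ (ξ-·₂ a→) ◅ ↠w) with pi-reducts ↠w
  ... | a' , b' , w≡ , a↠ , b↠ = a' , b' , w≡ , a→ ◅ a↠ , b↠
  pi-reducts (ξ-·₂ (ξ-ƛ b→) ◅ ↠w) with pi-reducts ↠w
  ... | a' , b' , w≡ , a↠ , b↠ = a' , b' , w≡ , a↠ , b→ ◅ b↠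

  pi-joinable : ∀ {Ψ} {a₁ a₂ : Tm Ψ ι} {b₁ b₂} →
                Joinable R (con cPi · a₁ · ƛ b₁) (con cPi · a₂ · ƛ b₂) →
                Joinable R a₁ a₂ × Joinable R b₁ b₂
  pi-joinable (w , ↠w₁ , ↠w₂) with pi-reducts ↠w₁ | pi-reducts ↠w₂
  ... | a , b , refl , a₁↠ , b₁↠ | .a , .b , refl , a₂↠ , b₂↠ =
    (a , a₁↠ , a₂↠) , (b , b₁↠ , b₂↠)

-- Encoding λΠ-terms as HRS-terms.  enc fv t is the encoding of t in which
-- the free variable i is interpreted by fv i; with first-order variables
-- this is [[t]].
Vars : HCtx → Set
Vars Ψ = ℕ → Tm Ψ ι

under : ∀ {Ψ} → Vars Ψ → Vars (ι ∷ Ψ)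
under fv zero    = ` Z
under fv (suc i) = renₕ S (fv i)

enc : ∀ {Ψ} → Vars Ψ → Term → Tm Ψ ι
enc fv kind      = con cKind
enc fv type      = con cType
enc fv (var i)   = fv i
enc fv (ocon c)  = con (cObj c)
enc fv (tcon C)  = con (cTyp C)
enc fv (app t u) = con cApp · enc fv t · enc fv u
enc fv (lam A t) = con cLam · enc fv A · ƛ (enc (under fv) t)
enc fv (pi A B)  = con cPi · enc fv A · ƛ (enc (under fv) B)

NeutralVars : ∀ {Ψ} → Vars Ψ → Set
NeutralVars fv = ∀ i → Ne (fv i)

under-Ne : ∀ {Ψ} {fv : Vars Ψ} → NeutralVars fv → NeutralVars (under fv)
under-Ne fv-ne zero    = ne-var
under-Ne fv-ne (suc i) = renₕ-Ne S (fv-ne i)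

enc-Nf : ∀ {Ψ} {fv : Vars Ψ} → NeutralVars fv → ∀ t → Nf (enc fv t)
enc-Nf fv-ne kind      = nf-ne ne-con
enc-Nf fv-ne type      = nf-ne ne-con
enc-Nf fv-ne (var i)   = nf-ne (fv-ne i)
enc-Nf fv-ne (ocon c)  = nf-ne ne-con
enc-Nf fv-ne (tcon C)  = nf-ne ne-con
enc-Nf fv-ne (app t u) = nf-ne (ne-app (ne-app ne-con (enc-Nf fv-ne t)) (enc-Nf fv-ne u))
enc-Nf fv-ne (lam A t) = nf-ne (ne-app (ne-app ne-con (enc-Nf fv-ne A)) (nf-ƛ (enc-Nf (under-Ne fv-ne) t)))
enc-Nf fv-ne (pi A B)  = nf-ne (ne-app (ne-app ne-con (enc-Nf fv-ne A)) (nf-ƛ (enc-Nf (under-Ne fv-ne) B)))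

under-ren : ∀ {Ψ Ψ'} {fv : Vars Ψ} {fv' : Vars Ψ'} {ρ} {r : Renₕ Ψ Ψ'} →
            (∀ i → fv' (ρ i) ≡ renₕ r (fv i)) → ∀ i → under fv' (extR ρ i) ≡ renₕ (extₕ r) (under fv i)
under-ren h zero    = refl
under-ren {fv = fv} {r = r} h (suc i) = trans (cong (renₕ S) (h i)) (sym (renₕ-shift r (fv i)))

enc-ren : ∀ {Ψ Ψ'} (fv : Vars Ψ) (fv' : Vars Ψ') ρ (r : Renₕ Ψ Ψ') →
          (∀ i → fv' (ρ i) ≡ renₕ r (fv i)) → ∀ t → enc fv' (ren ρ t) ≡ renₕ r (enc fv t)
enc-ren fv fv' ρ r h kind      = refl
enc-ren fv fv' ρ r h type      = refl
enc-ren fv fv' ρ r h (var i)   = h i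
enc-ren fv fv' ρ r h (ocon c)  = refl
enc-ren fv fv' ρ r h (tcon C)  = refl
enc-ren fv fv' ρ r h (app t u) =
  cong₂ (λ a b → con cApp · a · b) (enc-ren fv fv' ρ r h t) (enc-ren fv fv' ρ r h u)
enc-ren fv fv' ρ r h (lam A t) = cong₂ (λ a b → con cLam · a · ƛ b)
  (enc-ren fv fv' ρ r h A) (enc-ren (under fv) (under fv') (extR ρ) (extₕ r) (under-ren h) t)
enc-ren fv fv' ρ r h (pi A B)  = cong₂ (λ a b → con cPi · a · ƛ b)
  (enc-ren fv fv' ρ r h A) (enc-ren (under fv) (under fv') (extR ρ) (extₕ r) (under-ren h) B)

enc-shift : ∀ {Ψ} (fv : Vars Ψ) t → enc (under fv) (shift t) ≡ renₕ S (enc fv t)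
enc-shift fv = enc-ren fv (under fv) suc S (λ i → refl)

under-sub : ∀ {Ψ Ψ'} {fv : Vars Ψ} {fv' : Vars Ψ'} {θ} {τ : Subₕ Ψ Ψ'} →
            (∀ i → enc fv' (θ i) ≡ subₕ τ (fv i)) →
            ∀ i → enc (under fv') (extS θ i) ≡ subₕ (extsₕ τ) (under fv i)
under-sub h zero = refl
under-sub {fv = fv} {fv'} {θ} {τ} h (suc i) =
  trans (enc-shift fv' (θ i)) (trans (cong (renₕ S) (h i)) (sym (subₕ-shift τ (fv i))))

enc-sub : ∀ {Ψ Ψ'} (fv : Vars Ψ) (fv' : Vars Ψ') θ (τ : Subₕ Ψ Ψ') →
          (∀ i → enc fv' (θ i) ≡ subₕ τ (fv i)) → ∀ t → enc fv' (sub θ t) ≡ subₕ τ (enc fv t)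
enc-sub fv fv' θ τ h kind      = refl
enc-sub fv fv' θ τ h type      = refl
enc-sub fv fv' θ τ h (var i)   = h i
enc-sub fv fv' θ τ h (ocon c)  = refl
enc-sub fv fv' θ τ h (tcon C)  = refl
enc-sub fv fv' θ τ h (app t u) =
  cong₂ (λ a b → con cApp · a · b) (enc-sub fv fv' θ τ h t) (enc-sub fv fv' θ τ h u)
enc-sub fv fv' θ τ h (lam A t) = cong₂ (λ a b → con cLam · a · ƛ b)
  (enc-sub fv fv' θ τ h A) (enc-sub (under fv) (under fv') (extS θ) (extsₕ τ) (under-sub h) t)
enc-sub fv fv' θ τ h (pi A B)  = cong₂ (λ a b → con cPi · a · ƛ b)
  (enc-sub fv fv' θ τ h A) (enc-sub (under fv) (under fv') (extS θ) (extsₕ τ) (under-sub h) B)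

enc-[] : ∀ {Ψ} (fv : Vars Ψ) u v → enc fv (u [ v ]) ≡ subₕ (singleₕ (enc fv v)) (enc (under fv) u)
enc-[] fv u v = enc-sub (under fv) fv (single v) (singleₕ (enc fv v))
  (λ { zero → refl ; (suc i) → sym (subₕ-single-shift (enc fv v) (fv i)) }) u

-- The HRS-term  λy₁…yₙ. app(…app(c, y₁)…, yₙ)  of type termⁿ⁺¹: substituting
-- it for a free variable of arity n in an encoding yields the encoding of the
-- λΠ-substitution of c for that variable.  (Arguments of higher type do not
-- occur in encodings; they are simply discarded.)
liftApps : ∀ {Ψ} A → Tm Ψ ι → Tm Ψ A
liftApps ι               c = c
liftApps (ι ⇒ B)         c = ƛ (liftApps B (con cApp · renₕ S c · ` Z))
liftApps ((A₁ ⇒ A₂) ⇒ B) c = ƛ (liftApps B (renₕ S c))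

renₕ-liftApps : ∀ {Ψ Ψ'} (r : Renₕ Ψ Ψ') A c → renₕ r (liftApps A c) ≡ liftApps A (renₕ r c)
renₕ-liftApps r ι               c = refl
renₕ-liftApps r (ι ⇒ B)         c = cong ƛ (trans (renₕ-liftApps (extₕ r) B _)
  (cong (λ z → liftApps B (con cApp · z · ` Z)) (renₕ-shift r c)))
renₕ-liftApps r ((A₁ ⇒ A₂) ⇒ B) c = cong ƛ (trans (renₕ-liftApps (extₕ r) B _)
  (cong (liftApps B) (renₕ-shift r c)))

subₕ-liftApps : ∀ {Ψ Ψ'} (σ : Subₕ Ψ Ψ') A c → subₕ σ (liftApps A c) ≡ liftApps A (subₕ σ c)
subₕ-liftApps σ ι               c = refl
subₕ-liftApps σ (ι ⇒ B)         c = cong ƛ (trans (subₕ-liftApps (extsₕ σ) B _)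
  (cong (λ z → liftApps B (con cApp · z · ` Z)) (subₕ-shift σ c)))
subₕ-liftApps σ ((A₁ ⇒ A₂) ⇒ B) c = cong ƛ (trans (subₕ-liftApps (extsₕ σ) B _)
  (cong (liftApps B) (subₕ-shift σ c)))

liftApps-β : ∀ {Ψ} B (c a : Tm Ψ ι) → (liftApps (ι ⇒ B) c · a) =βη liftApps B (con cApp · c · a)
liftApps-β B c a = fwd β-ƛ ◅ ≡⇒=βη (trans (subₕ-liftApps (singleₕ a) B _)
  (cong (λ z → liftApps B (con cApp · z · a)) (subₕ-single-shift a c)))

encApps : ∀ {Ψ n} → Tm Ψ ι → Vec (Tm Ψ ι) n → Tm Ψ ι
encApps c []       = c
encApps c (a ∷ as) = encApps (con cApp · c · a) as

enc-sub-apps : ∀ {Ψ n} (fv : Vars Ψ) θ h (vs : Vec Term n) →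
               enc fv (sub θ (apps h vs)) ≡
               encApps (enc fv (sub θ h)) (Vec.map (enc fv ∘ sub θ) vs)
enc-sub-apps fv θ h []       = refl
enc-sub-apps fv θ h (v ∷ vs) = enc-sub-apps fv θ (app h v) vs

subₕ-applyN : ∀ {Ψ Ψ' n} (σ : Subₕ Ψ Ψ') (f : Tm Ψ (termTy n)) as →
              subₕ σ (applyN f as) ≡ applyN (subₕ σ f) (Vec.map (subₕ σ) as)
subₕ-applyN σ f []       = refl
subₕ-applyN σ f (a ∷ as) = subₕ-applyN σ (f · a) as

applyN-cong : ∀ {Ψ n} {f f' : Tm Ψ (termTy n)} (as : Vec (Tm Ψ ι) n) → f =βη f' →
              applyN f as =βη applyN f' as
applyN-cong as = EqC.gmap (λ f → applyN f as) (step as)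
  where
  step : ∀ {Ψ n} {f f' : Tm Ψ (termTy n)} (as : Vec (Tm Ψ ι) n) → f ⟶βη f' →
         applyN f as ⟶βη applyN f' as
  step []       f→f' = f→f'
  step (a ∷ as) f→f' = step as (ξ-·₁ f→f')

record Simulates {Φ Ψ} (k : ℕ) (τ : Subₕ (replicate k ι ++ Φ) Ψ) (fv : Vars Ψ) (θ : ℕ → Term)
                 : Set where
  field
    on-bound : ∀ i → τ (bvarₕ k i) ≡ enc fv (θ (toℕ i))
    on-meta  : ∀ {A} (x : Φ ∋ₕ A) → τ (metaₕ k x) ≡ liftApps A (enc fv (θ (k + ∋-index x)))
open Simulates

simulating : ∀ {Ψ} (Φ : HCtx) (fv : Vars Ψ) (θ : ℕ → Term) → Subₕ Φ Ψ
simulating Φ fv θ {A} x = liftApps A (enc fv (θ (∋-index x)))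

simulating-simulates : ∀ {Ψ} Φ (fv : Vars Ψ) θ → Simulates {Φ} 0 (simulating Φ fv θ) fv θ
simulating-simulates Φ fv θ = record { on-bound = λ () ; on-meta = λ x → refl }

Simulates-under : ∀ {Φ Ψ k} {τ : Subₕ (replicate k ι ++ Φ) Ψ} {fv : Vars Ψ} {θ} →
                  Simulates {Φ} k τ fv θ →
                  Simulates (suc k) (extsₕ τ) (under fv) (extS θ)
Simulates-under {fv = fv} {θ} τ∼θ = record
  { on-bound = λ { fz → refl
                 ; (fs i) → trans (cong (renₕ S) (on-bound τ∼θ i)) (sym (enc-shift fv (θ (toℕ i)))) }
  ; on-meta  = λ {A} x → trans (cong (renₕ S) (on-meta τ∼θ x))
                 (trans (renₕ-liftApps S A _)
                        (cong (liftApps A) (sym (enc-shift fv (θ (_ + ∋-index x)))))) }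

mutual
  instance-Enc : ∀ {Φ Ψ k} {τ : Subₕ (replicate k ι ++ Φ) Ψ} {fv : Vars Ψ} {θ t e} →
                 Simulates {Φ} k τ fv θ → Enc Φ k t e →
                 subₕ τ e =βη enc fv (sub θ t)
  instance-Enc τ∼θ e-kind = ε
  instance-Enc τ∼θ e-type = ε
  instance-Enc τ∼θ e-ocon = ε
  instance-Enc τ∼θ e-tcon = ε
  instance-Enc τ∼θ (e-bvar i) = ≡⇒=βη (on-bound τ∼θ i)
  instance-Enc τ∼θ (e-lam A↦a t↦b) =
    =βη-· (=βη-· ε (instance-Enc τ∼θ A↦a)) (=βη-ƛ (instance-Enc (Simulates-under τ∼θ) t↦b))
  instance-Enc τ∼θ (e-pi A↦a B↦b) =
    =βη-· (=βη-· ε (instance-Enc τ∼θ A↦a)) (=βη-ƛ (instance-Enc (Simulates-under τ∼θ) B↦b))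
  instance-Enc τ∼θ (e-app _ t↦a u↦b) = =βη-· (=βη-· ε (instance-Enc τ∼θ t↦a)) (instance-Enc τ∼θ u↦b)
  instance-Enc {k = k} {τ} {fv} {θ} τ∼θ (e-fvar {n} x {vs} {as} vs↦as) =
    ≡⇒=βη (trans (subₕ-applyN τ (` metaₕ k x) as)
                  (cong (λ f → applyN f (Vec.map (subₕ τ) as)) (on-meta τ∼θ x))) ◅◅
    instance-EncArgs τ∼θ vs↦as ε ◅◅
    ≡⇒=βη (sym (enc-sub-apps fv θ (var (k + ∋-index x)) vs))

  instance-EncArgs : ∀ {Φ Ψ k} {τ : Subₕ (replicate k ι ++ Φ) Ψ} {fv : Vars Ψ} {θ n}
                       {vs : Vec Term n} {as c c'} →
                     Simulates {Φ} k τ fv θ → EncArgs Φ k vs as → c =βη c' →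
                     applyN (liftApps (termTy n) c) (Vec.map (subₕ τ) as) =βη
                     encApps c' (Vec.map (enc fv ∘ sub θ) vs)
  instance-EncArgs τ∼θ ea-nil c=c' = c=c'
  instance-EncArgs {τ = τ} {n = suc n} {as = a ∷ as} {c} τ∼θ (ea-cons v↦a vs↦as) c=c' =
    applyN-cong (Vec.map (subₕ τ) as) (liftApps-β (termTy n) c (subₕ τ a)) ◅◅
    instance-EncArgs τ∼θ vs↦as (=βη-· (=βη-· ε c=c') (instance-Enc τ∼θ v↦a))

Scoped : ℕ → Term → Set
Scoped n t = ∀ i → Occurs i t → i < n

Scoped-weaken : ∀ {m n t} → m ≤ n → Scoped m t → Scoped n t
Scoped-weaken m≤n t-scoped i i∈t = <-≤-trans (t-scoped i i∈t) m≤n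

Scoped-body : ∀ {n t} → (∀ i → Occurs (suc i) t → i < n) → Scoped (suc n) t
Scoped-body h zero    _    = s≤s z≤n
Scoped-body h (suc i) i∈t = s≤s (h i i∈t)

Scoped-pi : ∀ {n A B} → Scoped n (pi A B) → Scoped n A × Scoped (suc n) B
Scoped-pi AB-scoped = (λ i i∈A → AB-scoped i (oc-piₗ i∈A))
                    , Scoped-body (λ i i∈B → AB-scoped i (oc-piᵣ i∈B))

bound : Term → ℕ
bound kind      = 0
bound type      = 0
bound (var i)   = suc i
bound (ocon _)  = 0
bound (tcon _)  = 0
bound (app t u) = bound t + bound u
bound (lam A t) = bound A + bound t
bound (pi A B)  = bound A + bound B

bound-Scoped : ∀ t → Scoped (bound t) t
bound-Scoped (var i)   .i oc-var           = n<1+n i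
bound-Scoped (app t u) i   (oc-appₗ i∈t) = <-≤-trans (bound-Scoped t i i∈t) (m≤m+n (bound t) (bound u))
bound-Scoped (app t u) i   (oc-appᵣ i∈u) = <-≤-trans (bound-Scoped u i i∈u) (m≤n+m (bound u) (bound t))
bound-Scoped (lam A t) i   (oc-lamₗ i∈A) = <-≤-trans (bound-Scoped A i i∈A) (m≤m+n (bound A) (bound t))
bound-Scoped (lam A t) i   (oc-lamᵣ i∈t) =
  <-≤-trans (<-trans (n<1+n i) (bound-Scoped t (suc i) i∈t)) (m≤n+m (bound t) (bound A))
bound-Scoped (pi A B)  i   (oc-piₗ i∈A)  = <-≤-trans (bound-Scoped A i i∈A) (m≤m+n (bound A) (bound B))
bound-Scoped (pi A B)  i   (oc-piᵣ i∈B)  =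
  <-≤-trans (<-trans (n<1+n i) (bound-Scoped B (suc i) i∈B)) (m≤n+m (bound B) (bound A))

Scoped-both : ∀ t u → Scoped (bound t + bound u) t × Scoped (bound t + bound u) u
Scoped-both t u = Scoped-weaken (m≤m+n (bound t) (bound u)) (bound-Scoped t)
                , Scoped-weaken (m≤n+m (bound u) (bound t)) (bound-Scoped u)

metaCtx : (ℕ → ℕ) → ℕ → HCtx
metaCtx ar zero    = []
metaCtx ar (suc M) = termTy (ar 0) ∷ metaCtx (ar ∘ suc) M

metaCtx-lookup : ∀ ar M j → j < M → Σ (metaCtx ar M ∋ₕ termTy (ar j)) λ x → ∋-index x ≡ j
metaCtx-lookup ar (suc M) zero    _         = Z , refl
metaCtx-lookup ar (suc M) (suc j) (s≤s j<M) with metaCtx-lookup (ar ∘ suc) M j j<M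
... | x , x≡j = S x , cong suc x≡j

Occurs-apps : ∀ {i n t} (vs : Vec Term n) → Occurs i t → Occurs i (apps t vs)
Occurs-apps []       i∈t = i∈t
Occurs-apps (v ∷ vs) i∈t = Occurs-apps vs (oc-appₗ i∈t)

module Encodable (ar : ℕ → ℕ) (M : ℕ) where
  mutual
    encodable : ∀ {k t} → Unif k ar t → Scoped (k + M) t → Σ _ (Enc (metaCtx ar M) k t)
    encodable u-kind      _ = _ , e-kind
    encodable u-type      _ = _ , e-type
    encodable u-ocon      _ = _ , e-ocon
    encodable u-tcon      _ = _ , e-tcon
    encodable (u-bvar i)  _ = _ , e-bvar i
    encodable {k} (u-fvar j {vs} vs-unif refl) t-scoped
      with metaCtx-lookup ar M j (+-cancelˡ-< k j M (t-scoped (k + j) (Occurs-apps vs oc-var)))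
         | encodable-args (var (k + j)) vs-unif t-scoped
    ... | x , x≡j | as , vs↦as =
      _ , subst (λ i → Enc (metaCtx ar M) k (apps (var (k + i)) vs) (applyN (` metaₕ k x) as)) x≡j
                (e-fvar x vs↦as)
    encodable (u-app t-head t-unif u-unif) tu-scoped =
      _ , e-app t-head (proj₂ (encodable t-unif (λ i i∈t → tu-scoped i (oc-appₗ i∈t))))
                       (proj₂ (encodable u-unif (λ i i∈u → tu-scoped i (oc-appᵣ i∈u))))
    encodable (u-lam A-unif t-unif) At-scoped =
      _ , e-lam (proj₂ (encodable A-unif (λ i i∈A → At-scoped i (oc-lamₗ i∈A))))
                (proj₂ (encodable t-unif (Scoped-body (λ i i∈t → At-scoped i (oc-lamᵣ i∈t)))))
    encodable (u-pi A-unif B-unif) AB-scoped =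
      _ , e-pi (proj₂ (encodable A-unif (λ i i∈A → AB-scoped i (oc-piₗ i∈A))))
               (proj₂ (encodable B-unif (Scoped-body (λ i i∈B → AB-scoped i (oc-piᵣ i∈B)))))

    encodable-args : ∀ {k n} {vs : Vec Term n} h → UnifArgs k ar vs → Scoped (k + M) (apps h vs) →
                     Σ _ (EncArgs (metaCtx ar M) k vs)
    encodable-args h ua-nil _ = [] , ea-nil
    encodable-args {vs = v ∷ vs} h (ua-cons v-unif vs-unif) hvs-scoped
      with encodable v-unif (λ i i∈v → hvs-scoped i (Occurs-apps vs (oc-appᵣ i∈v)))
         | encodable-args (app h v) vs-unif hvs-scoped
    ... | a , v↦a | as , vs↦as = a ∷ as , ea-cons v↦a vs↦as

instance-IsNFOf : ∀ {Φ Ψ} {fv : Vars Ψ} {t e} → NeutralVars fv → ∀ θ → Enc Φ 0 t e →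
                  IsNFOf (enc fv (sub θ t)) (subₕ (simulating Φ fv θ) e)
instance-IsNFOf {Φ} {fv = fv} {t} fv-ne θ t↦e =
  enc-Nf fv-ne (sub θ t) , =βη-sym (instance-Enc (simulating-simulates Φ fv θ) t↦e)

module Simulation (Γ : GCtx) (conds : ∀ u v → rule u v ∈ Γ → EncodingConditions u v) where
  open Conversion Γ using (_≈_)

  R : HRule → Set
  R = HRS-βΓ Γ

  simulate-rule : ∀ {Ψ} {fv : Vars Ψ} → NeutralVars fv → ∀ {l r} → rule l r ∈ Γ → ∀ σ →
                  Step R (enc fv (sub σ l)) (enc fv (sub σ r))
  simulate-rule {fv = fv} fv-ne {l} {r} l→r σ = from-conditions (conds l r l→r)
    where
    from-conditions : EncodingConditions l r → Step R (enc fv (sub σ l)) (enc fv (sub σ r))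
    from-conditions (_ , _ , ar , l-unif , r-unif)
      with Encodable.encodable ar (bound l + bound r) l-unif (proj₁ (Scoped-both l r))
         | Encodable.encodable ar (bound l + bound r) r-unif (proj₂ (Scoped-both l r))
    ... | _ , l↦ | _ , r↦ =
      root (inj₂ (l , r , l→r , l↦ , r↦)) (simulating _ fv σ)
           (instance-IsNFOf fv-ne σ l↦) (instance-IsNFOf fv-ne σ r↦)

  -- A β-step is a root step of app(lam(X, λx.Y(x)), Z) → Y(Z): the encoded
  -- redex is the instance of the left-hand side up to an η-step.
  simulate-β : ∀ {Ψ} {fv : Vars Ψ} → NeutralVars fv → ∀ A u v →
               Step R (enc fv (app (lam A u) v)) (enc fv (u [ v ]))
  simulate-β {Ψ} {fv} fv-ne A u v =
    root (inj₁ refl) redex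
      (enc-Nf fv-ne (app (lam A u) v) , bwd (ξ-·₁ (ξ-·₂ (ξ-·₂ η-ƛ))) ◅ ε)
      (enc-Nf fv-ne (u [ v ]) , ≡⇒=βη (enc-[] fv u v) ◅◅ bwd β-ƛ ◅ ε)
    where
    redex : Subₕ (ι ∷ (ι ⇒ ι) ∷ ι ∷ []) Ψ
    redex Z         = enc fv A
    redex (S Z)     = ƛ (enc (under fv) u)
    redex (S (S Z)) = enc fv v

  simulate : ∀ {Ψ} {fv : Vars Ψ} → NeutralVars fv → ∀ {t t'} → Γ ⊢ t ⟶ t' →
             Step R (enc fv t) (enc fv t')
  simulate fv-ne (β {A} {u} {v}) = simulate-β fv-ne A u v
  simulate fv-ne (γ l→r σ)       = simulate-rule fv-ne l→r σ
  simulate fv-ne (appₗ s)        = ξ-·₁ (ξ-·₂ (simulate fv-ne s))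
  simulate fv-ne (appᵣ s)        = ξ-·₂ (simulate fv-ne s)
  simulate fv-ne (lamₗ s)        = ξ-·₁ (ξ-·₂ (simulate fv-ne s))
  simulate fv-ne (lamᵣ s)        = ξ-·₂ (ξ-ƛ (simulate (under-Ne fv-ne) s))
  simulate fv-ne (piₗ s)         = ξ-·₁ (ξ-·₂ (simulate fv-ne s))
  simulate fv-ne (piᵣ s)         = ξ-·₂ (ξ-ƛ (simulate (under-Ne fv-ne) s))

  encode-joinable : Confluent R → ∀ {Ψ} {fv : Vars Ψ} → NeutralVars fv → ∀ {t t'} → t ≈ t' →
                    Joinable R (enc fv t) (enc fv t')
  encode-joinable confluent {fv = fv} fv-ne {t} ε = enc fv t , ε , ε
  encode-joinable confluent fv-ne (fwd s ◅ t₁≈t')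
    with encode-joinable confluent fv-ne t₁≈t'
  ... | w , t₁↠w , t'↠w = w , simulate fv-ne s ◅ t₁↠w , t'↠w
  encode-joinable confluent fv-ne (_◅_ {j = t₁} (bwd s) t₁≈t')
    with encode-joinable confluent fv-ne t₁≈t'
  ... | w , t₁↠w , t'↠w with confluent (enc-Nf fv-ne t₁) t₁↠w (simulate fv-ne s ◅ ε)
  ...   | w' , w↠w' , t↠w' = w' , t↠w' , t'↠w ◅◅ w↠w'

DecodesToSelf : ∀ {Ψ} → Vars Ψ → Term → Set
DecodesToSelf fv t = ∀ i → Occurs i t → decode (fv i) ≡ var i

DecodesToSelf-under : ∀ {Ψ} {fv : Vars Ψ} {t} → (∀ i → Occurs (suc i) t → decode (fv i) ≡ var i) →
                      DecodesToSelf (under fv) t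
DecodesToSelf-under h zero    _   = refl
DecodesToSelf-under {fv = fv} h (suc i) i∈t = trans (decode-shift (fv i)) (cong shift (h i i∈t))

-- The first-order variables 0, …, N-1 (indices from N on are never used).
firstOrder : ∀ N → Vars (replicate N ι)
firstOrder zero    _ = con cKind
firstOrder (suc N) = under (firstOrder N)

firstOrder-Ne : ∀ N → NeutralVars (firstOrder N)
firstOrder-Ne zero    _ = ne-con
firstOrder-Ne (suc N) = under-Ne (firstOrder-Ne N)

firstOrder-var : ∀ N i → i < N → decode (firstOrder N i) ≡ var i
firstOrder-var (suc N) zero    _         = refl
firstOrder-var (suc N) (suc i) (s≤s i<N) =
  trans (decode-shift (firstOrder N i)) (cong shift (firstOrder-var N i i<N))

firstOrder-decodes : ∀ {N t} → Scoped N t → DecodesToSelf (firstOrder N) t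
firstOrder-decodes {N} t-scoped i i∈t = firstOrder-var N i (t-scoped i i∈t)

module Recovery (Γ : GCtx) where
  open Conversion Γ
  open KripkeModel Γ

  decode-enc : ∀ {Ψ} (fv : Vars Ψ) t → DecodesToSelf fv t → decode (enc fv t) ≈ t
  decode-enc fv kind      _ = ε
  decode-enc fv type      _ = ε
  decode-enc fv (var i)   fv-self = ≡⇒≈ (fv-self i oc-var)
  decode-enc fv (ocon c)  _ = ε
  decode-enc fv (tcon C)  _ = ε
  decode-enc fv (app t u) fv-self = Dapp-β _ _ ◅◅ ≈-app
    (decode-enc fv t (λ i i∈t → fv-self i (oc-appₗ i∈t)))
    (decode-enc fv u (λ i i∈u → fv-self i (oc-appᵣ i∈u)))
  decode-enc fv (lam A t) fv-self = Dlam-β _ _ ◅◅ ≈-lam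
    (decode-enc fv A (λ i i∈A → fv-self i (oc-lamₗ i∈A)))
    (Dbody-β _ ◅◅ decode-enc (under fv) t (DecodesToSelf-under (λ i i∈t → fv-self i (oc-lamᵣ i∈t))))
  decode-enc fv (pi A B)  fv-self = Dpi-β _ _ ◅◅ ≈-pi
    (decode-enc fv A (λ i i∈A → fv-self i (oc-piₗ i∈A)))
    (Dbody-β _ ◅◅ decode-enc (under fv) B (DecodesToSelf-under (λ i i∈B → fv-self i (oc-piᵣ i∈B))))

  joinable⇒≈ : ∀ N {t t'} → Scoped N t → Scoped N t' →
               Joinable (HRS-βΓ Γ) (enc (firstOrder N) t) (enc (firstOrder N) t') → t ≈ t'
  joinable⇒≈ N {t} {t'} t-scoped t'-scoped (w , t↠w , t'↠w) =
    ≈-sym (decode-enc (firstOrder N) t (firstOrder-decodes t-scoped)) ◅◅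
    decode-sound N t↠w ◅◅ ≈-sym (decode-sound N t'↠w) ◅◅
    decode-enc (firstOrder N) t' (firstOrder-decodes t'-scoped)

mainTheorem10 : (Γ : GCtx) → IsGlobal Γ →
    (∀ u v → rule u v ∈ Γ → EncodingConditions u v) →
    Confluent (HRS-βΓ Γ) → PC Γ
mainTheorem10 Γ _ conds confluent {A₁ = A₁} {B₁} {A₂} {B₂} _ _ _ A₁B₁≈A₂B₂
  with Scoped-both (pi A₁ B₁) (pi A₂ B₂)
     | pi-joinable (encode-joinable confluent
                      (firstOrder-Ne (bound (pi A₁ B₁) + bound (pi A₂ B₂))) A₁B₁≈A₂B₂)
  where
  open Simulation Γ conds using (encode-joinable)
  open ProductReducts Γ conds using (pi-joinable)
... | A₁B₁-scoped , A₂B₂-scoped | A-joinable , B-joinable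
  with Scoped-pi A₁B₁-scoped | Scoped-pi A₂B₂-scoped
... | A₁-scoped , B₁-scoped | A₂-scoped , B₂-scoped =
  joinable⇒≈ _ A₁-scoped A₂-scoped A-joinable , joinable⇒≈ _ B₁-scoped B₂-scoped B-joinable
  where open Recovery Γ using (joinable⇒≈)
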